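{- Let $n=2k\ge 8$. Let $g_1,\dots,g_{2^{k-2}}$ be affine functions on $V_{k-2}$ such that exactly a quarter of them are based on each of $A,B,C,D$ and $g_i\oplus g_j$ is balanced for all $i\ne j$; let $h_i=\mathbf{O}(g_i)$; for $1\le i\le 2^{k-2}$ let $P_i=g_ih_ig_i\bar h_i$, $Q_i=\bar h_ig_ih_ig_i$, $P_{i+2^{k-2}}=h_i\bar g_i\bar h_i\bar g_i$, $Q_{i+2^{k-2}}=\bar g_i\bar h_i\bar g_ih_i$; and let $f$ be the function on $V_n$ with truth table $P_1\cdots P_{2^{k-1}}Q_1\cdots Q_{2^{k-1}}$. Then $\sigma_f=2^{2n+2}$, $N_f=2^{n-1}-2^{n/2}$, there are exactly four vectors $\alpha\in V_n$ (one of them $\alpha=0$) with $\Delta_f(\alpha)\ne 0$, and each of the three nonzero such vectors is a linear structure of $f$.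
   Context: $V_m=\mathbb{Z}_2^m$; truth tables are in lexicographic order; $\bar u$ is bitwise complement. $A=0011$, $B=0101$, $C=0110$, $D=0000$; a string is based on $M$ if it is a concatenation of 4-bit blocks each equal to $M$ or $\bar M$. For affine $g=X_1\cdots X_{2^{m-2}}$ (4-bit blocks) on $V_m$, $\mathbf{O}(g)=Y_1\cdots Y_{2^{m-2}}$ with $Y_1=X_1$ and, for $0\le i\le m-3$, $Y_{2^i+1}\cdots Y_{2^{i+1}}=\bar Y_1\cdots\bar Y_{2^i}$ if $X_{2^i+1}\cdots X_{2^{i+1}}=X_1\cdots X_{2^i}$, and $=Y_1\cdots Y_{2^i}$ if $X_{2^i+1}\cdots X_{2^{i+1}}=\bar X_1\cdots\bar X_{2^i}$. $\hat f=(-1)^f$, $\Delta_f(\alpha)=\sum_x\hat f(x)\hat f(x\oplus\alpha)$, $\sigma_f=\sum_\alpha\Delta_f(\alpha)^2$. $f$ satisfies the propagation criterion with respect to $\alpha$ iff $\Delta_f(\alpha)=0$. $N_f$ is the minimum Hamming distance from $f$ to an affine function. A nonzero $\alpha$ is a linear structure of $f$ if $f(x)\oplus f(x\oplus\alpha)$ is constant in $x$. -}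

module Defs where

open import Data.Bool using (Bool; true; false; not; _∧_; _∨_; _xor_; if_then_else_)
open import Data.Nat using (ℕ; zero; suc; _+_; _*_; _∸_; _^_; _⊓_)
open import Data.Integer as ℤ using (ℤ; +_; -_)
open import Data.Vec using (Vec; []; _∷_; take; drop; zipWith; map; replicate)
open import Data.Vec.Properties using (≡-dec)
open import Data.Product using (Σ; _×_)
open import Relation.Nullary using (¬_)
open import Relation.Nullary.Decidable using (⌊_⌋)
open import Relation.Binary.PropositionalEquality using (_≡_)
import Data.Bool.Properties as BP

-- V_m = Vec Bool m ; a Boolean function on V_m is  Vec Bool m → Bool.
-- Lexicographic truth tables: the first coordinate is the most significant bit.

BF : ℕ → Set
BF m = Vec Bool m → Bool

_⊕_ : ∀ {m} → Vec Bool m → Vec Bool m → Vec Bool m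
_⊕_ = zipWith _xor_

dot : ∀ {m} → Vec Bool m → Vec Bool m → Bool
dot [] [] = false
dot (a ∷ as) (x ∷ xs) = (a ∧ x) xor dot as xs

Affine : (m : ℕ) → BF m → Set
Affine m g = Σ (Vec Bool m) λ a → Σ Bool λ c → ∀ x → g x ≡ (dot a x xor c)

count : (m : ℕ) → (Vec Bool m → Bool) → ℕ
count zero P = if P [] then 1 else 0
count (suc m) P = count m (λ x → P (false ∷ x)) + count m (λ x → P (true ∷ x))

sumℤ : (m : ℕ) → (Vec Bool m → ℤ) → ℤ
sumℤ zero F = F []
sumℤ (suc m) F = sumℤ m (λ x → F (false ∷ x)) ℤ.+ sumℤ m (λ x → F (true ∷ x))

minOver : (m : ℕ) → (Vec Bool m → ℕ) → ℕ
minOver zero F = F []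
minOver (suc m) F = minOver m (λ x → F (false ∷ x)) ⊓ minOver m (λ x → F (true ∷ x))

eqB : (m : ℕ) → BF m → BF m → Bool
eqB zero f g = ⌊ f [] BP.≟ g [] ⌋
eqB (suc m) f g = eqB m (λ x → f (false ∷ x)) (λ x → g (false ∷ x))
                ∧ eqB m (λ x → f (true ∷ x)) (λ x → g (true ∷ x))

Balanced : (m : ℕ) → BF m → Set
Balanced m g = count m g ≡ count m (λ x → not (g x))

A B C D : Vec Bool 4
A = false ∷ false ∷ true ∷ true ∷ []
B = false ∷ true ∷ false ∷ true ∷ []
C = false ∷ true ∷ true ∷ false ∷ []
D = false ∷ false ∷ false ∷ false ∷ []

block : BF 2 → Vec Bool 4
block g = g (false ∷ false ∷ []) ∷ g (false ∷ true ∷ []) ∷ g (true ∷ false ∷ []) ∷ g (true ∷ true ∷ []) ∷ []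

basedOn : Vec Bool 4 → (j : ℕ) → BF (2 + j) → Bool
basedOn M zero g = ⌊ ≡-dec BP._≟_ (block g) M ⌋ ∨ ⌊ ≡-dec BP._≟_ (block g) (map not M) ⌋
basedOn M (suc j) g = basedOn M j (λ x → g (false ∷ x)) ∧ basedOn M j (λ x → g (true ∷ x))

-- The operator O on (affine) functions on V_{2+j}, following the recursive
-- doubling definition: Y_1 = X_1, and the second half of the first 2^{i+1}
-- blocks of Y is the complement of the first half when the corresponding
-- halves of X are equal, and equal to it when they are complementary.
O : (j : ℕ) → BF (2 + j) → BF (2 + j)
O zero g = g
O (suc j) g (false ∷ x) = O j (λ y → g (false ∷ y)) x
O (suc j) g (true ∷ x) =
  if eqB (2 + j) (λ y → g (true ∷ y)) (λ y → g (false ∷ y))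
  then not (O j (λ y → g (false ∷ y)) x)
  else O j (λ y → g (false ∷ y)) x

cat2 : ∀ {m} → BF m → BF m → BF (suc m)
cat2 T₁ T₂ (false ∷ x) = T₁ x
cat2 T₁ T₂ (true ∷ x) = T₂ x

cat4 : ∀ {m} → BF m → BF m → BF m → BF m → BF (2 + m)
cat4 T₁ T₂ T₃ T₄ = cat2 (cat2 T₁ T₂) (cat2 T₃ T₄)

-- concatenation of the 2^s truth tables T_y (y ∈ V_s in lexicographic order)
concatFam : (s t : ℕ) → (Vec Bool s → BF t) → BF (s + t)
concatFam s t T v = T (take s v) (drop s v)

compl : ∀ {m} → BF m → BF m
compl g x = not (g x)

-- The function f of Corollary 5, with k = 4 + j, m = k - 2 = 2 + j, n = k + k.
-- The family g_1,…,g_{2^{k-2}} is indexed by y ∈ V_{k-2} in lexicographic order.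
module Construction (j : ℕ) (g : Vec Bool (2 + j) → BF (2 + j)) where
  h : Vec Bool (2 + j) → BF (2 + j)
  h y = O j (g y)

  -- P_i (b = false) and P_{i+2^{k-2}} (b = true)
  P : Vec Bool (3 + j) → BF (4 + j)
  P (false ∷ y) = cat4 (g y) (h y) (g y) (compl (h y))
  P (true ∷ y) = cat4 (h y) (compl (g y)) (compl (h y)) (compl (g y))

  Q : Vec Bool (3 + j) → BF (4 + j)
  Q (false ∷ y) = cat4 (compl (h y)) (g y) (h y) (g y)
  Q (true ∷ y) = cat4 (compl (g y)) (compl (h y)) (compl (g y)) (h y)

  f : BF ((4 + j) + (4 + j))
  f = cat2 (concatFam (3 + j) (4 + j) P) (concatFam (3 + j) (4 + j) Q)

sign : Bool → ℤ
sign false = + 1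
sign true = - (+ 1)

Δ : (n : ℕ) → BF n → Vec Bool n → ℤ
Δ n f α = sumℤ n (λ x → sign (f x) ℤ.* sign (f (x ⊕ α)))

σ : (n : ℕ) → BF n → ℤ
σ n f = sumℤ n (λ α → Δ n f α ℤ.* Δ n f α)

dist : (n : ℕ) → BF n → BF n → ℕ
dist n f g = count n (λ x → f x xor g x)

N : (n : ℕ) → BF n → ℕ
N n f = minOver n (λ a → dist n f (dot a) ⊓ dist n f (λ x → not (dot a x)))

LinearStructure : (n : ℕ) → BF n → Vec Bool n → Set
LinearStructure n f α = ¬ (α ≡ replicate n false) × Σ Bool λ c → ∀ x → (f x xor f (x ⊕ α)) ≡ c

ΔnonzeroB : (n : ℕ) → BF n → Vec Bool n → Bool
ΔnonzeroB n f α = not ⌊ Δ n f α ℤ.≟ + 0 ⌋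

-- Write a point of V_n as (u, y, z) with u ∈ V_4 the bits that select one of the sixteen
-- quarter-blocks of the truth table, y ∈ V_{k-2} the index i of g_i and z ∈ V_{k-2} the
-- position inside it. For affine g, O(g) = g ⊕ s·x with s = 1⋯100, so writing
-- g_y(z) = L_y·z ⊕ e_y the table yields f(u, y, z) = (L_y ⊕ τ(u) s)·z ⊕ e_y ⊕ κ(u) for a linear
-- form τ and a function κ on V_4. Balancedness of g_y ⊕ g_y′ makes y ↦ L_y injective, so for
-- each value of τ(u) the (y, z)-part is a Maiorana–McFarland bent function. Splitting the sums
-- over u along the fibres of τ gives Δ_f(u, y, z) = 2^{2(k-2)} Δ_κ(u) if y = z = 0 and 0
-- otherwise, and W_f = T₀ W₀ + T₁ W₁ with |W_t| ≤ 2^{k-2} and |T₀| + |T₁| ≤ 8, with equality at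
-- one point. The remaining facts about κ are finite and checked by evaluation: σ_κ = 2^10 and
-- Δ_κ has exactly four nonzero values, all ±16. Finally |Δ_f(α)| = 2^n forces f(x) ⊕ f(x ⊕ α)
-- to be constant.

module Submission where

open import Defs
open import Data.Bool using (Bool; true; false; not; _∧_; _∨_; _xor_; if_then_else_)
import Data.Bool.Properties as BP
open import Data.Nat as ℕ using (ℕ; zero; suc; _+_; _*_; _∸_; _^_; _≤_)
import Data.Nat.Properties as ℕP
open import Data.Integer as ℤ using (ℤ; +_; -_; ∣_∣)
import Data.Integer.Properties as ℤP
open import Data.Integer.Tactic.RingSolver using (solve-∀)
import Data.Nat.Tactic.RingSolver as ℕSolver
open import Data.Vec using (Vec; []; _∷_; _++_; replicate; splitAt)
open import Data.Product using (Σ; ∃; _×_; _,_; proj₁; proj₂)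
open import Data.Sum using (_⊎_; inj₁; inj₂; [_,_]′)
open import Data.Empty using (⊥-elim)
open import Relation.Nullary using (Dec; yes; no; ¬_)
open import Relation.Nullary.Decidable using (True; toWitness; ⌊_⌋; _→-dec_; _×-dec_; _⊎-dec_)
open import Relation.Binary.PropositionalEquality
open import Data.Vec.Properties using (≡-dec)

decide : {P : Set} (p? : Dec P) → True p? → P
decide _ = toWitness

∀-Bool? : {P : Bool → Set} → (∀ b → Dec (P b)) → Dec (∀ b → P b)
∀-Bool? P? with P? false | P? true
... | yes p | yes q = yes λ { false → p ; true → q }
... | no ¬p | _     = no λ h → ¬p (h false)
... | yes _ | no ¬q = no λ h → ¬q (h true)

∀-Vec? : ∀ m {P : Vec Bool m → Set} → (∀ v → Dec (P v)) → Dec (∀ v → P v)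
∀-Vec? zero    P? with P? []
... | yes p = yes λ { [] → p }
... | no ¬p = no λ h → ¬p (h [])
∀-Vec? (suc m) P? with ∀-Bool? (λ b → ∀-Vec? m (λ v → P? (b ∷ v)))
... | yes p = yes λ { (b ∷ v) → p b v }
... | no ¬p = no λ h → ¬p (λ b v → h (b ∷ v))

0ᵥ : ∀ {m} → Vec Bool m
0ᵥ = replicate _ false

isZero : ∀ {m} → Vec Bool m → Bool
isZero []      = true
isZero (b ∷ v) = not b ∧ isZero v

isZero-0ᵥ : ∀ m → isZero (0ᵥ {m}) ≡ true
isZero-0ᵥ zero    = refl
isZero-0ᵥ (suc m) = isZero-0ᵥ m

isZero⇒≡0ᵥ : ∀ {m} (v : Vec Bool m) → isZero v ≡ true → v ≡ 0ᵥ
isZero⇒≡0ᵥ []          _ = refl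
isZero⇒≡0ᵥ (false ∷ v) e = cong (false ∷_) (isZero⇒≡0ᵥ v e)

⊕-comm : ∀ {m} (u v : Vec Bool m) → u ⊕ v ≡ v ⊕ u
⊕-comm []      []      = refl
⊕-comm (a ∷ u) (b ∷ v) = cong₂ _∷_ (BP.xor-comm a b) (⊕-comm u v)

⊕-assoc : ∀ {m} (u v w : Vec Bool m) → (u ⊕ v) ⊕ w ≡ u ⊕ (v ⊕ w)
⊕-assoc []      []      []      = refl
⊕-assoc (a ∷ u) (b ∷ v) (c ∷ w) = cong₂ _∷_ (BP.xor-assoc a b c) (⊕-assoc u v w)

⊕-self : ∀ {m} (u : Vec Bool m) → u ⊕ u ≡ 0ᵥ
⊕-self []      = refl
⊕-self (a ∷ u) = cong₂ _∷_ (BP.xor-same a) (⊕-self u)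

⊕-identityʳ : ∀ {m} (u : Vec Bool m) → u ⊕ 0ᵥ ≡ u
⊕-identityʳ []      = refl
⊕-identityʳ (a ∷ u) = cong₂ _∷_ (BP.xor-identityʳ a) (⊕-identityʳ u)

⊕-cancelʳ : ∀ {m} (u v : Vec Bool m) → (u ⊕ v) ⊕ v ≡ u
⊕-cancelʳ u v = trans (⊕-assoc u v v) (trans (cong (u ⊕_) (⊕-self v)) (⊕-identityʳ u))

isZero-⊕⇒≡ : ∀ {m} (u v : Vec Bool m) → isZero (u ⊕ v) ≡ true → u ≡ v
isZero-⊕⇒≡ u v e = begin
  u             ≡⟨ sym (⊕-cancelʳ u v) ⟩
  (u ⊕ v) ⊕ v   ≡⟨ cong (_⊕ v) (isZero⇒≡0ᵥ (u ⊕ v) e) ⟩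
  0ᵥ ⊕ v        ≡⟨ ⊕-comm 0ᵥ v ⟩
  v ⊕ 0ᵥ        ≡⟨ ⊕-identityʳ v ⟩
  v             ∎
  where open ≡-Reasoning

⊕-fixes⇒0ᵥ : ∀ {m} (y β : Vec Bool m) → y ⊕ β ≡ y → β ≡ 0ᵥ
⊕-fixes⇒0ᵥ y β y⊕β≡y = begin
  β              ≡⟨ ⊕-cancelʳ β y ⟨
  (β ⊕ y) ⊕ y    ≡⟨ cong (_⊕ y) (trans (⊕-comm β y) y⊕β≡y) ⟩
  y ⊕ y          ≡⟨ ⊕-self y ⟩
  0ᵥ             ∎
  where open ≡-Reasoning

isZero-⊕-self : ∀ {m} (u : Vec Bool m) → isZero (u ⊕ u) ≡ true
isZero-⊕-self {m} u = trans (cong isZero (⊕-self u)) (isZero-0ᵥ m)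

⊕-++ : ∀ {p q} (u u′ : Vec Bool p) (v v′ : Vec Bool q) → (u ++ v) ⊕ (u′ ++ v′) ≡ (u ⊕ u′) ++ (v ⊕ v′)
⊕-++ []      []       v v′ = refl
⊕-++ (a ∷ u) (b ∷ u′) v v′ = cong ((a xor b) ∷_) (⊕-++ u u′ v v′)

dot-++ : ∀ {p q} (u u′ : Vec Bool p) (v v′ : Vec Bool q) → dot (u ++ v) (u′ ++ v′) ≡ dot u u′ xor dot v v′
dot-++ []      []       v v′ = refl
dot-++ (a ∷ u) (b ∷ u′) v v′ = trans (cong ((a ∧ b) xor_) (dot-++ u u′ v v′)) (sym (BP.xor-assoc (a ∧ b) _ _))

dot-comm : ∀ {m} (u v : Vec Bool m) → dot u v ≡ dot v u
dot-comm []      []      = refl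
dot-comm (a ∷ u) (b ∷ v) = cong₂ _xor_ (BP.∧-comm a b) (dot-comm u v)

dot-zeroʳ : ∀ {m} (u : Vec Bool m) → dot u 0ᵥ ≡ false
dot-zeroʳ []      = refl
dot-zeroʳ (a ∷ u) = cong₂ _xor_ (BP.∧-zeroʳ a) (dot-zeroʳ u)

dot-⊕ʳ : ∀ {m} (u v w : Vec Bool m) → dot u (v ⊕ w) ≡ dot u v xor dot u w
dot-⊕ʳ []      []      []      = refl
dot-⊕ʳ (a ∷ u) (b ∷ v) (c ∷ w) = trans (cong ((a ∧ (b xor c)) xor_) (dot-⊕ʳ u v w)) (law a b c _ _)
  where
  law : ∀ a b c x y → (a ∧ (b xor c)) xor (x xor y) ≡ ((a ∧ b) xor x) xor ((a ∧ c) xor y)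
  law = decide (∀-Bool? λ a → ∀-Bool? λ b → ∀-Bool? λ c → ∀-Bool? λ x → ∀-Bool? λ y → _ BP.≟ _) _

dot-⊕ˡ : ∀ {m} (u v w : Vec Bool m) → dot (u ⊕ v) w ≡ dot u w xor dot v w
dot-⊕ˡ u v w = trans (dot-comm (u ⊕ v) w) (trans (dot-⊕ʳ w u v) (cong₂ _xor_ (dot-comm w u) (dot-comm w v)))

sign-xor : ∀ a b → sign (a xor b) ≡ sign a ℤ.* sign b
sign-xor false false = refl
sign-xor false true  = refl
sign-xor true  false = refl
sign-xor true  true  = refl

sign-not : ∀ a → sign (not a) ≡ - sign a
sign-not false = refl
sign-not true  = refl

sign-square : ∀ a → sign a ℤ.* sign a ≡ + 1
sign-square false = refl
sign-square true  = refl

∣sign∣ : ∀ a → ∣ sign a ∣ ≡ 1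
∣sign∣ false = refl
∣sign∣ true  = refl

sign≤1 : ∀ a → sign a ℤ.≤ + 1
sign≤1 false = ℤP.≤-refl
sign≤1 true  = ℤ.-≤+

indicator : Bool → ℤ
indicator b = if b then + 1 else + 0

+2^suc : ∀ m → + (2 ^ suc m) ≡ + (2 ^ m) ℤ.+ + (2 ^ m)
+2^suc m = cong (λ k → + (2 ^ m + k)) (ℕP.+-identityʳ (2 ^ m))

sumℤ-cong : ∀ m {F G : Vec Bool m → ℤ} → (∀ x → F x ≡ G x) → sumℤ m F ≡ sumℤ m G
sumℤ-cong zero    e = e []
sumℤ-cong (suc m) e = cong₂ ℤ._+_ (sumℤ-cong m (λ x → e (false ∷ x))) (sumℤ-cong m (λ x → e (true ∷ x)))

sumℤ-zero : ∀ m → sumℤ m (λ _ → + 0) ≡ + 0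
sumℤ-zero zero    = refl
sumℤ-zero (suc m) = cong₂ ℤ._+_ (sumℤ-zero m) (sumℤ-zero m)

sumℤ-+ : ∀ m (F G : Vec Bool m → ℤ) → sumℤ m (λ x → F x ℤ.+ G x) ≡ sumℤ m F ℤ.+ sumℤ m G
sumℤ-+ zero    F G = refl
sumℤ-+ (suc m) F G = trans
  (cong₂ ℤ._+_ (sumℤ-+ m (λ x → F (false ∷ x)) (λ x → G (false ∷ x)))
               (sumℤ-+ m (λ x → F (true ∷ x)) (λ x → G (true ∷ x))))
  (interchange (sumℤ m (λ x → F (false ∷ x))) (sumℤ m (λ x → G (false ∷ x)))
               (sumℤ m (λ x → F (true ∷ x))) (sumℤ m (λ x → G (true ∷ x))))
  where
  interchange : ∀ a b c d → (a ℤ.+ b) ℤ.+ (c ℤ.+ d) ≡ (a ℤ.+ c) ℤ.+ (b ℤ.+ d)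
  interchange = solve-∀

sumℤ-*ˡ : ∀ m c (F : Vec Bool m → ℤ) → sumℤ m (λ x → c ℤ.* F x) ≡ c ℤ.* sumℤ m F
sumℤ-*ˡ zero    c F = refl
sumℤ-*ˡ (suc m) c F = trans
  (cong₂ ℤ._+_ (sumℤ-*ˡ m c (λ x → F (false ∷ x))) (sumℤ-*ˡ m c (λ x → F (true ∷ x))))
  (sym (ℤP.*-distribˡ-+ c _ _))

sumℤ-*ʳ : ∀ m (F : Vec Bool m → ℤ) c → sumℤ m (λ x → F x ℤ.* c) ≡ sumℤ m F ℤ.* c
sumℤ-*ʳ m F c = begin
  sumℤ m (λ x → F x ℤ.* c)  ≡⟨ sumℤ-cong m (λ x → ℤP.*-comm (F x) c) ⟩
  sumℤ m (λ x → c ℤ.* F x)  ≡⟨ sumℤ-*ˡ m c F ⟩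
  c ℤ.* sumℤ m F            ≡⟨ ℤP.*-comm c _ ⟩
  sumℤ m F ℤ.* c            ∎
  where open ≡-Reasoning

sumℤ-neg : ∀ m (F : Vec Bool m → ℤ) → sumℤ m (λ x → - F x) ≡ - sumℤ m F
sumℤ-neg m F = begin
  sumℤ m (λ x → - F x)          ≡⟨ sumℤ-cong m (λ x → sym (ℤP.-1*i≡-i (F x))) ⟩
  sumℤ m (λ x → - + 1 ℤ.* F x)  ≡⟨ sumℤ-*ˡ m (- + 1) F ⟩
  - + 1 ℤ.* sumℤ m F            ≡⟨ ℤP.-1*i≡-i _ ⟩
  - sumℤ m F                    ∎
  where open ≡-Reasoning

sumℤ-const : ∀ m c → sumℤ m (λ _ → c) ≡ + (2 ^ m) ℤ.* c
sumℤ-const zero    c = sym (ℤP.*-identityˡ c)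
sumℤ-const (suc m) c = begin
  sumℤ m (λ _ → c) ℤ.+ sumℤ m (λ _ → c)             ≡⟨ cong₂ ℤ._+_ (sumℤ-const m c) (sumℤ-const m c) ⟩
  + (2 ^ m) ℤ.* c ℤ.+ + (2 ^ m) ℤ.* c               ≡⟨ ℤP.*-distribʳ-+ c (+ (2 ^ m)) (+ (2 ^ m)) ⟨
  (+ (2 ^ m) ℤ.+ + (2 ^ m)) ℤ.* c                   ≡⟨ cong (ℤ._* c) (+2^suc m) ⟨
  + (2 ^ suc m) ℤ.* c                               ∎
  where open ≡-Reasoning

sumℤ-++ : ∀ p q (F : Vec Bool (p + q) → ℤ) → sumℤ (p + q) F ≡ sumℤ p (λ u → sumℤ q (λ v → F (u ++ v)))
sumℤ-++ zero    q F = refl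
sumℤ-++ (suc p) q F = cong₂ ℤ._+_ (sumℤ-++ p q (λ x → F (false ∷ x))) (sumℤ-++ p q (λ x → F (true ∷ x)))

sumℤ-swap : ∀ p q (F : Vec Bool p → Vec Bool q → ℤ) →
            sumℤ p (λ u → sumℤ q (λ v → F u v)) ≡ sumℤ q (λ v → sumℤ p (λ u → F u v))
sumℤ-swap zero    q F = refl
sumℤ-swap (suc p) q F = trans
  (cong₂ ℤ._+_ (sumℤ-swap p q (λ u → F (false ∷ u))) (sumℤ-swap p q (λ u → F (true ∷ u))))
  (sym (sumℤ-+ q (λ v → sumℤ p (λ u → F (false ∷ u) v)) (λ v → sumℤ p (λ u → F (true ∷ u) v))))

sumℤ-sign-dot : ∀ m (v : Vec Bool m) → sumℤ m (λ z → sign (dot v z)) ≡ (if isZero v then + (2 ^ m) else + 0)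
sumℤ-sign-dot zero    []          = refl
sumℤ-sign-dot (suc m) (false ∷ v) with isZero v | sumℤ-sign-dot m v
... | true  | e = trans (cong₂ ℤ._+_ e e) (sym (+2^suc m))
... | false | e = cong₂ ℤ._+_ e e
sumℤ-sign-dot (suc m) (true ∷ v) = begin
  S ℤ.+ sumℤ m (λ z → sign (not (dot v z)))  ≡⟨ cong (λ t → S ℤ.+ t) (sumℤ-cong m (λ z → sign-not (dot v z))) ⟩
  S ℤ.+ sumℤ m (λ z → - sign (dot v z))      ≡⟨ cong (λ t → S ℤ.+ t) (sumℤ-neg m (λ z → sign (dot v z))) ⟩
  S ℤ.+ - S                                  ≡⟨ ℤP.+-inverseʳ S ⟩
  + 0                                        ∎
  where
  open ≡-Reasoning
  S = sumℤ m (λ z → sign (dot v z))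

sumℤ-point : ∀ m (F : Vec Bool m → ℤ) v → sumℤ m (λ x → if isZero (x ⊕ v) then F x else + 0) ≡ F v
sumℤ-point zero    F []          = refl
sumℤ-point (suc m) F (false ∷ v) = trans
  (cong₂ ℤ._+_ (sumℤ-point m (λ x → F (false ∷ x)) v) (sumℤ-zero m))
  (ℤP.+-identityʳ (F (false ∷ v)))
sumℤ-point (suc m) F (true ∷ v)  = trans
  (cong₂ ℤ._+_ (sumℤ-zero m) (sumℤ-point m (λ x → F (true ∷ x)) v))
  (ℤP.+-identityˡ (F (true ∷ v)))

search : ∀ m (P : Vec Bool m → Bool) → (∀ x → P x ≡ false) ⊎ ∃ λ x → P x ≡ true
search zero    P with P [] in e
... | true  = inj₂ ([] , e)
... | false = inj₁ λ { [] → e }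
search (suc m) P with search m (λ x → P (false ∷ x)) | search m (λ x → P (true ∷ x))
... | inj₂ (x , e) | _            = inj₂ (false ∷ x , e)
... | inj₁ _       | inj₂ (x , e) = inj₂ (true ∷ x , e)
... | inj₁ none₀   | inj₁ none₁   = inj₁ λ { (false ∷ x) → none₀ x ; (true ∷ x) → none₁ x }

sumℤ-none : ∀ m (P : Vec Bool m → Bool) (F : Vec Bool m → ℤ) → (∀ y → P y ≡ false) →
            sumℤ m (λ y → if P y then F y else + 0) ≡ + 0
sumℤ-none m P F none = trans (sumℤ-cong m (λ y → cong (λ b → if b then F y else + 0) (none y))) (sumℤ-zero m)

sumℤ-unique : ∀ m (P : Vec Bool m → Bool) (F : Vec Bool m → ℤ) y₀ → P y₀ ≡ true →
              (∀ y → P y ≡ true → y ≡ y₀) → sumℤ m (λ y → if P y then F y else + 0) ≡ F y₀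
sumℤ-unique m P F y₀ Py₀ unique = trans (sumℤ-cong m agree) (sumℤ-point m F y₀)
  where
  agree : ∀ y → (if P y then F y else + 0) ≡ (if isZero (y ⊕ y₀) then F y else + 0)
  agree y with P y in Py | isZero (y ⊕ y₀) in y≡y₀
  ... | true  | true  = refl
  ... | false | false = refl
  ... | true  | false with () ← trans (sym y≡y₀) (subst (λ w → isZero (w ⊕ y₀) ≡ true) (sym (unique y Py)) (isZero-⊕-self y₀))
  ... | false | true  with () ← trans (sym Py) (subst (λ w → P w ≡ true) (sym (isZero-⊕⇒≡ y y₀ y≡y₀)) Py₀)

sumℤ-atMostOne : ∀ m (P : Vec Bool m → Bool) (F : Vec Bool m → ℤ) →
                 (∀ y y′ → P y ≡ true → P y′ ≡ true → y ≡ y′) →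
                 (sumℤ m (λ y → if P y then F y else + 0) ≡ + 0) ⊎ ∃ λ y₀ → sumℤ m (λ y → if P y then F y else + 0) ≡ F y₀
sumℤ-atMostOne m P F atMostOne with search m P
... | inj₁ none        = inj₁ (sumℤ-none m P F none)
... | inj₂ (y₀ , Py₀) = inj₂ (y₀ , sumℤ-unique m P F y₀ Py₀ (λ y Py → atMostOne y y₀ Py Py₀))

sumℤ-≤ : ∀ m (F : Vec Bool m → ℤ) → (∀ x → F x ℤ.≤ + 1) → sumℤ m F ℤ.≤ + (2 ^ m)
sumℤ-≤ zero    F F≤1 = F≤1 []
sumℤ-≤ (suc m) F F≤1 = subst (sumℤ (suc m) F ℤ.≤_) (sym (+2^suc m))
  (ℤP.+-mono-≤ (sumℤ-≤ m (λ x → F (false ∷ x)) (λ x → F≤1 (false ∷ x)))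
               (sumℤ-≤ m (λ x → F (true ∷ x)) (λ x → F≤1 (true ∷ x))))

+-both-maximal : ∀ {a b n} → a ℤ.≤ n → b ℤ.≤ n → a ℤ.+ b ≡ n ℤ.+ n → a ≡ n × b ≡ n
+-both-maximal {a} {b} {n} a≤n b≤n a+b≡n+n with a ℤP.≟ n | b ℤP.≟ n
... | yes a≡n | yes b≡n = a≡n , b≡n
... | no  a≢n | _       = ⊥-elim (ℤP.<-irrefl a+b≡n+n (ℤP.+-mono-<-≤ (ℤP.≤∧≢⇒< a≤n a≢n) b≤n))
... | yes _   | no  b≢n = ⊥-elim (ℤP.<-irrefl a+b≡n+n (ℤP.+-mono-≤-< a≤n (ℤP.≤∧≢⇒< b≤n b≢n)))

sumℤ-maximal : ∀ m (F : Vec Bool m → ℤ) → (∀ x → F x ℤ.≤ + 1) → sumℤ m F ≡ + (2 ^ m) → ∀ x → F x ≡ + 1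
sumℤ-maximal zero    F F≤1 ΣF≡ [] = ΣF≡
sumℤ-maximal (suc m) F F≤1 ΣF≡ (b ∷ x) = sumℤ-maximal m (λ x → F (b ∷ x)) (λ x → F≤1 (b ∷ x)) (half b) x
  where
  halves : sumℤ m (λ x → F (false ∷ x)) ≡ + (2 ^ m) × sumℤ m (λ x → F (true ∷ x)) ≡ + (2 ^ m)
  halves = +-both-maximal (sumℤ-≤ m (λ x → F (false ∷ x)) (λ x → F≤1 (false ∷ x)))
                          (sumℤ-≤ m (λ x → F (true ∷ x)) (λ x → F≤1 (true ∷ x)))
                          (trans ΣF≡ (+2^suc m))
  half : ∀ b → sumℤ m (λ x → F (b ∷ x)) ≡ + (2 ^ m)
  half false = proj₁ halves
  half true  = proj₂ halves

-- Every u has exactly one preimage: at most one by injectivity, and the counts add up to 2^m.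
sumℤ-reindex : ∀ m (M : Vec Bool m → Vec Bool m) → (∀ y y′ → M y ≡ M y′ → y ≡ y′) →
               (G : Vec Bool m → ℤ) → sumℤ m (λ y → G (M y)) ≡ sumℤ m G
sumℤ-reindex m M M-injective G = sym (begin
  sumℤ m G                                                                   ≡⟨ sumℤ-cong m (λ u → sym (trans (cong (G u ℤ.*_) (hits≡1 u)) (ℤP.*-identityʳ (G u)))) ⟩
  sumℤ m (λ u → G u ℤ.* hits u)                                              ≡⟨ sumℤ-cong m (λ u → sym (sumℤ-*ˡ m (G u) (λ y → hit y u))) ⟩
  sumℤ m (λ u → sumℤ m (λ y → G u ℤ.* hit y u))                              ≡⟨ sumℤ-swap m m (λ u y → G u ℤ.* hit y u) ⟩
  sumℤ m (λ y → sumℤ m (λ u → G u ℤ.* hit y u))                              ≡⟨ sumℤ-cong m (λ y → sumℤ-cong m (λ u → select y u)) ⟩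
  sumℤ m (λ y → sumℤ m (λ u → if isZero (u ⊕ M y) then G u else + 0))        ≡⟨ sumℤ-cong m (λ y → sumℤ-point m G (M y)) ⟩
  sumℤ m (λ y → G (M y))                                                     ∎)
  where
  open ≡-Reasoning
  hit : Vec Bool m → Vec Bool m → ℤ
  hit y u = indicator (isZero (M y ⊕ u))
  hits : Vec Bool m → ℤ
  hits u = sumℤ m (λ y → hit y u)
  select : ∀ y u → G u ℤ.* hit y u ≡ (if isZero (u ⊕ M y) then G u else + 0)
  select y u rewrite ⊕-comm (M y) u with isZero (u ⊕ M y)
  ... | true  = ℤP.*-identityʳ (G u)
  ... | false = ℤP.*-zeroʳ (G u)
  hits≤1 : ∀ u → hits u ℤ.≤ + 1
  hits≤1 u with sumℤ-atMostOne m (λ y → isZero (M y ⊕ u)) (λ _ → + 1)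
                  (λ y y′ e e′ → M-injective y y′ (trans (isZero-⊕⇒≡ (M y) u e) (sym (isZero-⊕⇒≡ (M y′) u e′))))
  ... | inj₁ none     = subst (ℤ._≤ + 1) (sym none) (ℤ.+≤+ ℕ.z≤n)
  ... | inj₂ (_ , one) = subst (ℤ._≤ + 1) (sym one) ℤP.≤-refl
  total : sumℤ m hits ≡ + (2 ^ m)
  total = begin
    sumℤ m hits                                                            ≡⟨ sumℤ-swap m m (λ u y → hit y u) ⟩
    sumℤ m (λ y → sumℤ m (λ u → hit y u))                                  ≡⟨ sumℤ-cong m (λ y → sumℤ-cong m (λ u → cong (λ w → indicator (isZero w)) (⊕-comm (M y) u))) ⟩
    sumℤ m (λ y → sumℤ m (λ u → indicator (isZero (u ⊕ M y))))             ≡⟨ sumℤ-cong m (λ y → sumℤ-point m (λ _ → + 1) (M y)) ⟩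
    sumℤ m (λ _ → + 1)                                                     ≡⟨ sumℤ-const m (+ 1) ⟩
    + (2 ^ m) ℤ.* + 1                                                      ≡⟨ ℤP.*-identityʳ _ ⟩
    + (2 ^ m)                                                              ∎
  hits≡1 : ∀ u → hits u ≡ + 1
  hits≡1 = sumℤ-maximal m hits hits≤1 total

fibre : ∀ {m} → (Vec Bool m → Bool) → Bool → (Vec Bool m → ℤ) → Vec Bool m → ℤ
fibre p t F u = if ⌊ p u BP.≟ t ⌋ then F u else + 0

sumℤ-fibres : ∀ m (p : Vec Bool m → Bool) (F : Vec Bool m → ℤ) (G : Bool → ℤ) →
  sumℤ m (λ u → F u ℤ.* G (p u)) ≡ sumℤ m (fibre p false F) ℤ.* G false ℤ.+ sumℤ m (fibre p true F) ℤ.* G true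
sumℤ-fibres m p F G = begin
  sumℤ m (λ u → F u ℤ.* G (p u))
    ≡⟨ sumℤ-cong m (λ u → split u (p u) refl) ⟩
  sumℤ m (λ u → fibre p false F u ℤ.* G false ℤ.+ fibre p true F u ℤ.* G true)
    ≡⟨ sumℤ-+ m _ _ ⟩
  sumℤ m (λ u → fibre p false F u ℤ.* G false) ℤ.+ sumℤ m (λ u → fibre p true F u ℤ.* G true)
    ≡⟨ cong₂ ℤ._+_ (sumℤ-*ʳ m (fibre p false F) (G false)) (sumℤ-*ʳ m (fibre p true F) (G true)) ⟩
  sumℤ m (fibre p false F) ℤ.* G false ℤ.+ sumℤ m (fibre p true F) ℤ.* G true
    ∎
  where
  open ≡-Reasoning
  split : ∀ u b → p u ≡ b → F u ℤ.* G b ≡ fibre p false F u ℤ.* G false ℤ.+ fibre p true F u ℤ.* G true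
  split u false pu≡ rewrite pu≡ = sym (trans (cong (λ v → F u ℤ.* G false ℤ.+ v) (ℤP.*-zeroˡ (G true))) (ℤP.+-identityʳ _))
  split u true  pu≡ rewrite pu≡ = sym (trans (cong (λ v → v ℤ.+ F u ℤ.* G true) (ℤP.*-zeroˡ (G false))) (ℤP.+-identityˡ _))

≟0-*ˡ : ∀ k w → ¬ k ≡ + 0 → ⌊ k ℤ.* w ℤP.≟ + 0 ⌋ ≡ ⌊ w ℤP.≟ + 0 ⌋
≟0-*ˡ k w k≢0 with k ℤ.* w ℤP.≟ + 0 | w ℤP.≟ + 0
... | yes _     | yes _   = refl
... | no  _     | no  _   = refl
... | yes kw≡0 | no  w≢0 = ⊥-elim ([ k≢0 , w≢0 ]′ (ℤP.i*j≡0⇒i≡0∨j≡0 k kw≡0))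
... | no  kw≢0 | yes w≡0 = ⊥-elim (kw≢0 (trans (cong (k ℤ.*_) w≡0) (ℤP.*-zeroʳ k)))

+2^≢0 : ∀ m → ¬ + (2 ^ m) ≡ + 0
+2^≢0 m eq = ℕP.<⇒≢ (ℕP.m^n>0 2 m) (sym (ℤP.+-injective eq))

count-cong : ∀ m {P Q : Vec Bool m → Bool} → (∀ x → P x ≡ Q x) → count m P ≡ count m Q
count-cong zero    e = cong (λ b → if b then 1 else 0) (e [])
count-cong (suc m) e = cong₂ _+_ (count-cong m (λ x → e (false ∷ x))) (count-cong m (λ x → e (true ∷ x)))

count-indicator : ∀ m (P : Vec Bool m → Bool) → + count m P ≡ sumℤ m (λ x → indicator (P x))
count-indicator zero    P with P []
... | true  = refl
... | false = refl
count-indicator (suc m) P = trans (ℤP.pos-+ (count m (λ x → P (false ∷ x))) _)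
  (cong₂ ℤ._+_ (count-indicator m (λ x → P (false ∷ x))) (count-indicator m (λ x → P (true ∷ x))))

count-true : ∀ m → count m (λ _ → true) ≡ 2 ^ m
count-true zero    = refl
count-true (suc m) = cong₂ _+_ (count-true m) (trans (count-true m) (sym (ℕP.+-identityʳ (2 ^ m))))

count-false : ∀ m → count m (λ _ → false) ≡ 0
count-false zero    = refl
count-false (suc m) = cong₂ _+_ (count-false m) (count-false m)

constant-not-balanced : ∀ m c → ¬ Balanced m (λ _ → c)
constant-not-balanced m true  eq = ℕP.<⇒≢ (ℕP.m^n>0 2 m) (sym (trans (sym (count-true m)) (trans eq (count-false m))))
constant-not-balanced m false eq = ℕP.<⇒≢ (ℕP.m^n>0 2 m) (trans (sym (count-false m)) (trans eq (count-true m)))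

count-sign : ∀ m (P : Vec Bool m → Bool) → sumℤ m (λ x → sign (P x)) ℤ.+ + (count m P + count m P) ≡ + (2 ^ m)
count-sign m P = begin
  sumℤ m (λ x → sign (P x)) ℤ.+ + (count m P + count m P)
    ≡⟨ cong (λ t → sumℤ m (λ x → sign (P x)) ℤ.+ t) (trans (ℤP.pos-+ (count m P) _) (cong₂ ℤ._+_ (count-indicator m P) (count-indicator m P))) ⟩
  sumℤ m (λ x → sign (P x)) ℤ.+ (sumℤ m (λ x → indicator (P x)) ℤ.+ sumℤ m (λ x → indicator (P x)))
    ≡⟨ cong (λ t → sumℤ m (λ x → sign (P x)) ℤ.+ t) (sumℤ-+ m _ _) ⟨
  sumℤ m (λ x → sign (P x)) ℤ.+ sumℤ m (λ x → indicator (P x) ℤ.+ indicator (P x))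
    ≡⟨ sumℤ-+ m _ _ ⟨
  sumℤ m (λ x → sign (P x) ℤ.+ (indicator (P x) ℤ.+ indicator (P x)))
    ≡⟨ sumℤ-cong m (λ x → sign+2indicator (P x)) ⟩
  sumℤ m (λ _ → + 1)
    ≡⟨ trans (sumℤ-const m (+ 1)) (ℤP.*-identityʳ _) ⟩
  + (2 ^ m) ∎
  where
  open ≡-Reasoning
  sign+2indicator : ∀ b → sign b ℤ.+ (indicator b ℤ.+ indicator b) ≡ + 1
  sign+2indicator false = refl
  sign+2indicator true  = refl

minOver-≤ : ∀ m (F : Vec Bool m → ℕ) a → minOver m F ≤ F a
minOver-≤ zero    F []      = ℕP.≤-refl
minOver-≤ (suc m) F (false ∷ a) = ℕP.≤-trans (ℕP.m⊓n≤m _ _) (minOver-≤ m _ a)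
minOver-≤ (suc m) F (true ∷ a)  = ℕP.≤-trans (ℕP.m⊓n≤n _ _) (minOver-≤ m _ a)

minOver-greatest : ∀ m (F : Vec Bool m → ℕ) b → (∀ a → b ≤ F a) → b ≤ minOver m F
minOver-greatest zero    F b b≤ = b≤ []
minOver-greatest (suc m) F b b≤ = ℕP.⊓-glb (minOver-greatest m _ b (λ a → b≤ (false ∷ a)))
                                           (minOver-greatest m _ b (λ a → b≤ (true ∷ a)))

walsh : (n : ℕ) → BF n → Vec Bool n → ℤ
walsh n h ω = sumℤ n (λ x → sign (h x xor dot ω x))

walsh+distance : ∀ n h ω → walsh n h ω ℤ.+ + (dist n h (dot ω) + dist n h (dot ω)) ≡ + (2 ^ n)
walsh+distance n h ω = count-sign n (λ x → h x xor dot ω x)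

-walsh+distance : ∀ n h ω → - walsh n h ω ℤ.+ + (dist n h (compl (dot ω)) + dist n h (compl (dot ω))) ≡ + (2 ^ n)
-walsh+distance n h ω = begin
  - walsh n h ω ℤ.+ + (d + d)                                    ≡⟨ cong (ℤ._+ + (d + d)) (sumℤ-neg n _) ⟨
  sumℤ n (λ x → - sign (h x xor dot ω x)) ℤ.+ + (d + d)          ≡⟨ cong (ℤ._+ + (d + d)) (sumℤ-cong n flip) ⟩
  sumℤ n (λ x → sign (h x xor not (dot ω x))) ℤ.+ + (d + d)      ≡⟨ count-sign n (λ x → h x xor not (dot ω x)) ⟩
  + (2 ^ n)                                                      ∎
  where
  open ≡-Reasoning
  d : ℕ
  d = dist n h (compl (dot ω))
  flip : ∀ x → - sign (h x xor dot ω x) ≡ sign (h x xor not (dot ω x))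
  flip x = trans (sym (sign-not (h x xor dot ω x))) (cong sign (BP.not-distribʳ-xor (h x) (dot ω x)))

i≤+∣i∣ : ∀ i → i ℤ.≤ + ∣ i ∣
i≤+∣i∣ (+ n)    = ℤP.≤-refl
i≤+∣i∣ ℤ.-[1+ n ] = ℤ.-≤+

∣i∣≡n⇒ : ∀ i {n} → ∣ i ∣ ≡ n → i ≡ + n ⊎ - i ≡ + n
∣i∣≡n⇒ (+ n)      refl = inj₁ refl
∣i∣≡n⇒ ℤ.-[1+ n ] refl = inj₂ refl

∣i∣≤n⇒ : ∀ i {n} → ∣ i ∣ ≤ n → i ℤ.≤ + n × - i ℤ.≤ + n
∣i∣≤n⇒ i ∣i∣≤n = ℤP.≤-trans (i≤+∣i∣ i) (ℤ.+≤+ ∣i∣≤n)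
              , ℤP.≤-trans (i≤+∣i∣ (- i)) (ℤ.+≤+ (subst (_≤ _) (sym (ℤP.∣-i∣≡∣i∣ i)) ∣i∣≤n))

k+k≡2*k : ∀ k → k + k ≡ 2 * k
k+k≡2*k k = cong (λ t → k + t) (sym (ℕP.+-identityʳ k))

[c+c]+[d+d]≡2*[c+d] : ∀ c d → (c + c) + (d + d) ≡ 2 * (c + d)
[c+c]+[d+d]≡2*[c+d] = ℕSolver.solve-∀

distance-lower-bound : ∀ {W} d P c → W ℤ.≤ + (c + c) → W ℤ.+ + (d + d) ≡ + (P + P) → P ∸ c ≤ d
distance-lower-bound {W} d P c W≤ W+2d≡2P = ℕP.m≤n+o⇒m∸n≤o P c (ℕP.*-cancelˡ-≤ 2 2P≤2[c+d])
  where
  2P≤2[c+d] : 2 * P ≤ 2 * (c + d)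
  2P≤2[c+d] = subst₂ _≤_ (k+k≡2*k P) ([c+c]+[d+d]≡2*[c+d] c d)
    (ℤP.drop‿+≤+ (subst₂ ℤ._≤_ W+2d≡2P (sym (ℤP.pos-+ (c + c) (d + d))) (ℤP.+-monoˡ-≤ (+ (d + d)) W≤)))

distance-exact : ∀ {W} d P c → W ≡ + (c + c) → W ℤ.+ + (d + d) ≡ + (P + P) → d ≡ P ∸ c
distance-exact {W} d P c W≡ W+2d≡2P = begin
  d          ≡⟨ ℕP.m+n∸m≡n c d ⟨
  c + d ∸ c  ≡⟨ cong (_∸ c) c+d≡P ⟩
  P ∸ c      ∎
  where
  open ≡-Reasoning
  c+d≡P : c + d ≡ P
  c+d≡P = ℕP.*-cancelˡ-≡ (c + d) P 2 (begin
    2 * (c + d)        ≡⟨ [c+c]+[d+d]≡2*[c+d] c d ⟨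
    (c + c) + (d + d)  ≡⟨ ℤP.+-injective (trans (ℤP.pos-+ (c + c) (d + d)) (trans (cong (ℤ._+ + (d + d)) (sym W≡)) W+2d≡2P)) ⟩
    P + P              ≡⟨ k+k≡2*k P ⟩
    2 * P              ∎)

nonlinearity-from-walsh : ∀ n (h : BF (suc n)) c →
  (∀ ω → ∣ walsh (suc n) h ω ∣ ≤ c + c) → ∀ ω₀ → ∣ walsh (suc n) h ω₀ ∣ ≡ c + c →
  N (suc n) h ≡ 2 ^ n ∸ c
nonlinearity-from-walsh n h c bounded ω₀ peak = ℕP.≤-antisym upper lower
  where
  W : Vec Bool (suc n) → ℤ
  W = walsh (suc n) h
  d₁ d₂ : Vec Bool (suc n) → ℕ
  d₁ ω = dist (suc n) h (dot ω)
  d₂ ω = dist (suc n) h (compl (dot ω))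
  2^n+2^n : ∀ {a} → a ≡ + (2 ^ suc n) → a ≡ + (2 ^ n + 2 ^ n)
  2^n+2^n e = trans e (trans (+2^suc n) (sym (ℤP.pos-+ (2 ^ n) (2 ^ n))))
  lower : 2 ^ n ∸ c ≤ N (suc n) h
  lower = minOver-greatest (suc n) (λ ω → d₁ ω ℕ.⊓ d₂ ω) (2 ^ n ∸ c) λ ω →
    ℕP.⊓-glb (distance-lower-bound (d₁ ω) (2 ^ n) c (proj₁ (∣i∣≤n⇒ (W ω) (bounded ω))) (2^n+2^n (walsh+distance (suc n) h ω)))
             (distance-lower-bound (d₂ ω) (2 ^ n) c (proj₂ (∣i∣≤n⇒ (W ω) (bounded ω))) (2^n+2^n (-walsh+distance (suc n) h ω)))
  N≤ : ∀ ω → N (suc n) h ≤ d₁ ω ℕ.⊓ d₂ ω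
  N≤ = minOver-≤ (suc n) (λ ω → d₁ ω ℕ.⊓ d₂ ω)
  upper : N (suc n) h ≤ 2 ^ n ∸ c
  upper with ∣i∣≡n⇒ (W ω₀) peak
  ... | inj₁ W≡  = ℕP.≤-trans (N≤ ω₀) (ℕP.≤-trans (ℕP.m⊓n≤m _ _)
                     (ℕP.≤-reflexive (distance-exact (d₁ ω₀) (2 ^ n) c W≡ (2^n+2^n (walsh+distance (suc n) h ω₀)))))
  ... | inj₂ -W≡ = ℕP.≤-trans (N≤ ω₀) (ℕP.≤-trans (ℕP.m⊓n≤n _ _)
                     (ℕP.≤-reflexive (distance-exact (d₂ ω₀) (2 ^ n) c -W≡ (2^n+2^n (-walsh+distance (suc n) h ω₀)))))

Δ-zero : ∀ n (h : BF n) → Δ n h 0ᵥ ≡ + (2 ^ n)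
Δ-zero n h = begin
  sumℤ n (λ x → sign (h x) ℤ.* sign (h (x ⊕ 0ᵥ)))  ≡⟨ sumℤ-cong n (λ x → trans (cong (λ y → sign (h x) ℤ.* sign (h y)) (⊕-identityʳ x)) (sign-square (h x))) ⟩
  sumℤ n (λ _ → + 1)                              ≡⟨ sumℤ-const n (+ 1) ⟩
  + (2 ^ n) ℤ.* + 1                               ≡⟨ ℤP.*-identityʳ _ ⟩
  + (2 ^ n)                                       ∎
  where open ≡-Reasoning

sign≡1⇒false : ∀ {b} → sign b ≡ + 1 → b ≡ false
sign≡1⇒false {false} _ = refl

Δ-extremal⇒linear : ∀ n (h : BF n) α → ∣ Δ n h α ∣ ≡ 2 ^ n → Σ Bool λ c → ∀ x → h x xor h (x ⊕ α) ≡ c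
Δ-extremal⇒linear n h α ∣Δ∣≡2^n with ∣i∣≡n⇒ (Δ n h α) ∣Δ∣≡2^n
... | inj₁ Δ≡  = false , λ x → sign≡1⇒false (sumℤ-maximal n term (λ x → sign≤1 (h x xor h (x ⊕ α))) (trans (sumℤ-cong n term≡) Δ≡) x)
  where
  term : Vec Bool n → ℤ
  term x = sign (h x xor h (x ⊕ α))
  term≡ : ∀ x → term x ≡ sign (h x) ℤ.* sign (h (x ⊕ α))
  term≡ x = sign-xor (h x) (h (x ⊕ α))
... | inj₂ -Δ≡ = true , λ x → trans (sym (BP.not-involutive _))
                   (cong not (sign≡1⇒false (sumℤ-maximal n term (λ x → sign≤1 (not (h x xor h (x ⊕ α)))) (trans term≡ -Δ≡) x)))
  where
  term : Vec Bool n → ℤ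
  term x = sign (not (h x xor h (x ⊕ α)))
  term≡ : sumℤ n term ≡ - Δ n h α
  term≡ = trans (sumℤ-cong n (λ x → trans (sign-not (h x xor h (x ⊕ α))) (cong -_ (sign-xor (h x) (h (x ⊕ α)))))) (sumℤ-neg n _)

-- Maiorana–McFarland functions

module MaioranaMcFarland {m : ℕ} (M : Vec Bool m → Vec Bool m) (c : Vec Bool m → Bool)
                         (M-injective : ∀ y y′ → M y ≡ M y′ → y ≡ y′) where

  mm : Vec Bool m → Vec Bool m → Bool
  mm y z = dot (M y) z xor c y

  isZero-M⊕M : ∀ y β → isZero (M y ⊕ M (y ⊕ β)) ≡ isZero β
  isZero-M⊕M y β with isZero β in β≡0 | isZero (M y ⊕ M (y ⊕ β)) in M≡M
  ... | true  | true  = refl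
  ... | false | false = refl
  ... | true  | false = trans (sym M≡M) (subst (λ w → isZero (M y ⊕ M (y ⊕ w)) ≡ true) (sym (isZero⇒≡0ᵥ β β≡0))
                          (trans (cong (λ w → isZero (M y ⊕ M w)) (⊕-identityʳ y)) (isZero-⊕-self (M y))))
  ... | false | true  = sym (trans (sym β≡0) (trans (cong isZero β≡0ᵥ) (isZero-0ᵥ m)))
    where
    β≡0ᵥ : β ≡ 0ᵥ
    β≡0ᵥ = ⊕-fixes⇒0ᵥ y β (sym (M-injective y (y ⊕ β) (isZero-⊕⇒≡ (M y) (M (y ⊕ β)) M≡M)))

  mm-difference : ∀ y y′ z γ → mm y z xor mm y′ (z ⊕ γ) ≡ dot (M y ⊕ M y′) z xor ((c y xor c y′) xor dot (M y′) γ)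
  mm-difference y y′ z γ rewrite dot-⊕ʳ (M y′) z γ | dot-⊕ˡ (M y) (M y′) z =
    law (dot (M y) z) (dot (M y′) z) (dot (M y′) γ) (c y) (c y′)
    where
    law : ∀ a b g p q → (a xor p) xor ((b xor g) xor q) ≡ (a xor b) xor ((p xor q) xor g)
    law = decide (∀-Bool? λ a → ∀-Bool? λ b → ∀-Bool? λ g → ∀-Bool? λ p → ∀-Bool? λ q → _ BP.≟ _) _

  mm-autocorrelation : ∀ β γ →
    sumℤ m (λ y → sumℤ m (λ z → sign (mm y z xor mm (y ⊕ β) (z ⊕ γ))))
      ≡ (if isZero β ∧ isZero γ then + (2 ^ m) ℤ.* + (2 ^ m) else + 0)
  mm-autocorrelation β γ = trans (sumℤ-cong m inner) (outer (isZero β) refl)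
    where
    open ≡-Reasoning
    K : ℤ
    K = + (2 ^ m)
    k : Vec Bool m → Bool
    k y = (c y xor c (y ⊕ β)) xor dot (M (y ⊕ β)) γ
    inner : ∀ y → sumℤ m (λ z → sign (mm y z xor mm (y ⊕ β) (z ⊕ γ))) ≡ (if isZero β then K else + 0) ℤ.* sign (k y)
    inner y = begin
      sumℤ m (λ z → sign (mm y z xor mm (y ⊕ β) (z ⊕ γ)))         ≡⟨ sumℤ-cong m (λ z → trans (cong sign (mm-difference y (y ⊕ β) z γ)) (sign-xor (dot (M y ⊕ M (y ⊕ β)) z) (k y))) ⟩
      sumℤ m (λ z → sign (dot (M y ⊕ M (y ⊕ β)) z) ℤ.* sign (k y)) ≡⟨ sumℤ-*ʳ m _ (sign (k y)) ⟩
      sumℤ m (λ z → sign (dot (M y ⊕ M (y ⊕ β)) z)) ℤ.* sign (k y) ≡⟨ cong (ℤ._* sign (k y)) (sumℤ-sign-dot m (M y ⊕ M (y ⊕ β))) ⟩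
      (if isZero (M y ⊕ M (y ⊕ β)) then K else + 0) ℤ.* sign (k y) ≡⟨ cong (λ b → (if b then K else + 0) ℤ.* sign (k y)) (isZero-M⊕M y β) ⟩
      (if isZero β then K else + 0) ℤ.* sign (k y)                 ∎
    outer : ∀ b → isZero β ≡ b → sumℤ m (λ y → (if b then K else + 0) ℤ.* sign (k y)) ≡ (if b ∧ isZero γ then K ℤ.* K else + 0)
    outer false _ = trans (sumℤ-cong m (λ y → ℤP.*-zeroˡ (sign (k y)))) (sumℤ-zero m)
    outer true  β≡0 = begin
      sumℤ m (λ y → K ℤ.* sign (k y))                 ≡⟨ sumℤ-*ˡ m K _ ⟩
      K ℤ.* sumℤ m (λ y → sign (k y))                 ≡⟨ cong (K ℤ.*_) (sumℤ-cong m k≡) ⟩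
      K ℤ.* sumℤ m (λ y → sign (dot γ (M y)))         ≡⟨ cong (K ℤ.*_) (sumℤ-reindex m M M-injective (λ u → sign (dot γ u))) ⟩
      K ℤ.* sumℤ m (λ u → sign (dot γ u))             ≡⟨ cong (K ℤ.*_) (sumℤ-sign-dot m γ) ⟩
      K ℤ.* (if isZero γ then K else + 0)             ≡⟨ scale (isZero γ) ⟩
      (if isZero γ then K ℤ.* K else + 0)             ∎
      where
      y⊕β≡y : ∀ y → y ⊕ β ≡ y
      y⊕β≡y y = trans (cong (y ⊕_) (isZero⇒≡0ᵥ β β≡0)) (⊕-identityʳ y)
      k≡ : ∀ y → sign (k y) ≡ sign (dot γ (M y))
      k≡ y = cong sign (trans (cong (λ u → (c y xor c u) xor dot (M u) γ) (y⊕β≡y y))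
                              (trans (cong (_xor dot (M y) γ) (BP.xor-same (c y))) (dot-comm (M y) γ)))
      scale : ∀ b → K ℤ.* (if b then K else + 0) ≡ (if b then K ℤ.* K else + 0)
      scale true  = refl
      scale false = ℤP.*-zeroʳ K

  mm-walsh : ∀ ωy ωz →
    sumℤ m (λ y → sumℤ m (λ z → sign ((mm y z xor dot ωy y) xor dot ωz z)))
      ≡ + (2 ^ m) ℤ.* sumℤ m (λ y → if isZero (M y ⊕ ωz) then sign (c y xor dot ωy y) else + 0)
  mm-walsh ωy ωz = trans (sumℤ-cong m inner) (sumℤ-*ˡ m K _)
    where
    open ≡-Reasoning
    K : ℤ
    K = + (2 ^ m)
    inner : ∀ y → sumℤ m (λ z → sign ((mm y z xor dot ωy y) xor dot ωz z))
                  ≡ K ℤ.* (if isZero (M y ⊕ ωz) then sign (c y xor dot ωy y) else + 0)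
    inner y = begin
      sumℤ m (λ z → sign ((mm y z xor dot ωy y) xor dot ωz z))            ≡⟨ sumℤ-cong m (λ z → trans (cong sign (split z)) (sign-xor (dot (M y ⊕ ωz) z) s)) ⟩
      sumℤ m (λ z → sign (dot (M y ⊕ ωz) z) ℤ.* sign s)                   ≡⟨ sumℤ-*ʳ m _ (sign s) ⟩
      sumℤ m (λ z → sign (dot (M y ⊕ ωz) z)) ℤ.* sign s                   ≡⟨ cong (ℤ._* sign s) (sumℤ-sign-dot m (M y ⊕ ωz)) ⟩
      (if isZero (M y ⊕ ωz) then K else + 0) ℤ.* sign s                   ≡⟨ select (isZero (M y ⊕ ωz)) ⟩
      K ℤ.* (if isZero (M y ⊕ ωz) then sign s else + 0)                   ∎
      where
      s : Bool
      s = c y xor dot ωy y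
      split : ∀ z → (mm y z xor dot ωy y) xor dot ωz z ≡ dot (M y ⊕ ωz) z xor s
      split z rewrite dot-⊕ˡ (M y) ωz z = law (dot (M y) z) (c y) (dot ωy y) (dot ωz z)
        where
        law : ∀ a p q b → ((a xor p) xor q) xor b ≡ (a xor b) xor (p xor q)
        law = decide (∀-Bool? λ a → ∀-Bool? λ p → ∀-Bool? λ q → ∀-Bool? λ b → _ BP.≟ _) _
      select : ∀ b → (if b then K else + 0) ℤ.* sign s ≡ K ℤ.* (if b then sign s else + 0)
      select true  = refl
      select false = sym (ℤP.*-zeroʳ K)

  mm-walsh-bound : ∀ ωy ωz → ∣ sumℤ m (λ y → sumℤ m (λ z → sign ((mm y z xor dot ωy y) xor dot ωz z))) ∣ ≤ 2 ^ m
  mm-walsh-bound ωy ωz rewrite mm-walsh ωy ωz | ℤP.abs-* (+ (2 ^ m)) (sumℤ m (λ y → if isZero (M y ⊕ ωz) then sign (c y xor dot ωy y) else + 0))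
    with sumℤ-atMostOne m (λ y → isZero (M y ⊕ ωz)) (λ y → sign (c y xor dot ωy y))
           (λ y y′ e e′ → M-injective y y′ (trans (isZero-⊕⇒≡ (M y) ωz e) (sym (isZero-⊕⇒≡ (M y′) ωz e′))))
  ... | inj₁ none        rewrite none = ℕP.≤-trans (ℕP.≤-reflexive (ℕP.*-zeroʳ (2 ^ m))) ℕ.z≤n
  ... | inj₂ (y₀ , one) rewrite one | ∣sign∣ (c y₀ xor dot ωy y₀) = ℕP.≤-reflexive (ℕP.*-identityʳ (2 ^ m))

  mm-walsh-peak : ∀ y₀ → sumℤ m (λ y → sumℤ m (λ z → sign ((mm y z xor dot 0ᵥ y) xor dot (M y₀) z))) ≡ + (2 ^ m) ℤ.* sign (c y₀)
  mm-walsh-peak y₀ = trans (mm-walsh 0ᵥ (M y₀)) (cong (+ (2 ^ m) ℤ.*_) (begin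
    sumℤ m (λ y → if isZero (M y ⊕ M y₀) then sign (c y xor dot 0ᵥ y) else + 0)
      ≡⟨ sumℤ-unique m (λ y → isZero (M y ⊕ M y₀)) _ y₀ (isZero-⊕-self (M y₀))
           (λ y e → M-injective y y₀ (isZero-⊕⇒≡ (M y) (M y₀) e)) ⟩
    sign (c y₀ xor dot 0ᵥ y₀)
      ≡⟨ cong (λ b → sign (c y₀ xor b)) (trans (dot-comm 0ᵥ y₀) (dot-zeroʳ y₀)) ⟩
    sign (c y₀ xor false)
      ≡⟨ cong sign (BP.xor-identityʳ (c y₀)) ⟩
    sign (c y₀) ∎))
    where open ≡-Reasoning

-- The operator O on affine functions

∧≡true : ∀ {a b} → a ∧ b ≡ true → a ≡ true × b ≡ true
∧≡true {true} {true} _ = refl , refl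

eqB-complete : ∀ m (g h : BF m) → (∀ x → g x ≡ h x) → eqB m g h ≡ true
eqB-complete zero    g h g≡h rewrite g≡h [] with h []
... | false = refl
... | true  = refl
eqB-complete (suc m) g h g≡h = cong₂ _∧_ (eqB-complete m _ _ (λ x → g≡h (false ∷ x))) (eqB-complete m _ _ (λ x → g≡h (true ∷ x)))

eqB-sound : ∀ m (g h : BF m) → eqB m g h ≡ true → ∀ x → g x ≡ h x
eqB-sound zero    g h eq [] with g [] | h []
... | false | false = refl
... | true  | true  = refl
eqB-sound (suc m) g h eq (false ∷ x) = eqB-sound m _ _ (proj₁ (∧≡true eq)) x
eqB-sound (suc m) g h eq (true ∷ x)  = eqB-sound m _ _ (proj₂ (∧≡true eq)) x

leadingOnes : (j : ℕ) → Vec Bool (2 + j)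
leadingOnes zero    = false ∷ false ∷ []
leadingOnes (suc j) = true ∷ leadingOnes j

module _ {m} {g : BF (suc m)} {a₁ : Bool} {a : Vec Bool m} {c : Bool}
         (g≡ : ∀ x → g x ≡ dot (a₁ ∷ a) x xor c) where

  affine-lower : ∀ y → g (false ∷ y) ≡ dot a y xor c
  affine-lower y = trans (g≡ (false ∷ y)) (cong (λ b → (b xor dot a y) xor c) (BP.∧-zeroʳ a₁))

  affine-upper : ∀ y → g (true ∷ y) ≡ a₁ xor g (false ∷ y)
  affine-upper y = begin
    g (true ∷ y)                   ≡⟨ g≡ (true ∷ y) ⟩
    ((a₁ ∧ true) xor dot a y) xor c ≡⟨ cong (λ b → (b xor dot a y) xor c) (BP.∧-identityʳ a₁) ⟩
    (a₁ xor dot a y) xor c          ≡⟨ BP.xor-assoc a₁ (dot a y) c ⟩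
    a₁ xor (dot a y xor c)          ≡⟨ cong (a₁ xor_) (affine-lower y) ⟨
    a₁ xor g (false ∷ y)            ∎
    where open ≡-Reasoning

eqB-affine-halves : ∀ {m} {g : BF (suc m)} a₁ a c → (∀ x → g x ≡ dot (a₁ ∷ a) x xor c) →
                    eqB m (λ y → g (true ∷ y)) (λ y → g (false ∷ y)) ≡ not a₁
eqB-affine-halves {m} false a c g≡ = eqB-complete m _ _ (affine-upper g≡)
eqB-affine-halves {m} {g} true a c g≡ with eqB m (λ y → g (true ∷ y)) (λ y → g (false ∷ y)) in halves≡
... | false = refl
... | true  = ⊥-elim (BP.not-¬ (eqB-sound m _ _ halves≡ 0ᵥ) (affine-upper g≡ 0ᵥ))

O-affine : ∀ j (g : BF (2 + j)) → Affine (2 + j) g → ∀ x → O j g x ≡ g x xor dot (leadingOnes j) x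
O-affine zero    g _ (x₁ ∷ x₂ ∷ []) = sym (BP.xor-identityʳ (g (x₁ ∷ x₂ ∷ [])))
O-affine (suc j) g (a₁ ∷ a , c , g≡) (false ∷ x) = O-affine j _ (a , c , affine-lower g≡) x
O-affine (suc j) g (a₁ ∷ a , c , g≡) (true ∷ x)
  rewrite eqB-affine-halves a₁ a c g≡ | O-affine j _ (a , c , affine-lower g≡) x | affine-upper g≡ x =
  law a₁ (g (false ∷ x)) (dot (leadingOnes j) x)
  where
  law : ∀ a₁ G S → (if not a₁ then not (G xor S) else (G xor S)) ≡ (a₁ xor G) xor not S
  law = decide (∀-Bool? λ a₁ → ∀-Bool? λ G → ∀-Bool? λ S → _ BP.≟ _) _

-- The sixteen quarter-blocks

τ : Vec Bool 4 → Bool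
τ = dot (true ∷ true ∷ false ∷ true ∷ [])

τ-⊕ : ∀ u v → τ (u ⊕ v) ≡ τ u xor τ v
τ-⊕ = dot-⊕ʳ (true ∷ true ∷ false ∷ true ∷ [])

κ : BF 4
κ (a ∷ b ∷ c₁ ∷ c₂ ∷ []) = a xor (if a xor b then c₁ ∨ c₂ else c₁ ∧ c₂)

block₄ : Bool → Bool → Bool → Bool → BF 2
block₄ w₁ w₂ w₃ w₄ = cat4 (λ _ → w₁) (λ _ → w₂) (λ _ → w₃) (λ _ → w₄)

-- Row (a, b) = 00, 01, 10, 11 lists the quarters of P_i, P_{i+2^{k-2}}, Q_i, Q_{i+2^{k-2}}
-- at position z, with G = g_i(z) and H = h_i(z).
entry : Vec Bool 4 → Bool → Bool → Bool
entry (false ∷ false ∷ c) G H = block₄ G H G (not H) c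
entry (false ∷ true  ∷ c) G H = block₄ H (not G) (not H) (not G) c
entry (true  ∷ false ∷ c) G H = block₄ (not H) G H G c
entry (true  ∷ true  ∷ c) G H = block₄ (not G) (not H) (not G) H c

entry-normal-form : ∀ u G S → entry u G (G xor S) ≡ (G xor (τ u ∧ S)) xor κ u
entry-normal-form = decide (∀-Vec? 4 λ u → ∀-Bool? λ G → ∀-Bool? λ S → _ BP.≟ _) _

κ-correlation-fibre : Bool → Vec Bool 4 → ℤ
κ-correlation-fibre t α = sumℤ 4 (fibre τ t (λ u → sign (κ u) ℤ.* sign (κ (u ⊕ α))))

κ-correlation-fibres-vanish : ∀ α → τ α ≡ true →
  κ-correlation-fibre false α ≡ + 0 × κ-correlation-fibre true α ≡ + 0 × Δ 4 κ α ≡ + 0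
κ-correlation-fibres-vanish = decide (∀-Vec? 4 λ α → (τ α BP.≟ true) →-dec
  ((_ ℤP.≟ + 0) ×-dec (_ ℤP.≟ + 0) ×-dec (_ ℤP.≟ + 0))) _

σ-κ : σ 4 κ ≡ + 1024
σ-κ = refl

count-κ : sumℤ 4 (λ α → indicator (ΔnonzeroB 4 κ α)) ≡ + 4
count-κ = refl

κ-Δ-values : ∀ α → ∣ Δ 4 κ α ∣ ≡ 0 ⊎ ∣ Δ 4 κ α ∣ ≡ 16
κ-Δ-values = decide (∀-Vec? 4 λ α → (_ ℕ.≟ 0) ⊎-dec (_ ℕ.≟ 16)) _

κ-walsh-fibre : Bool → Vec Bool 4 → ℤ
κ-walsh-fibre t ω = sumℤ 4 (fibre τ t (λ u → sign (κ u xor dot ω u)))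

κ-walsh-fibres-bound : ∀ ω → ∣ κ-walsh-fibre false ω ∣ + ∣ κ-walsh-fibre true ω ∣ ≤ 8
κ-walsh-fibres-bound = decide (∀-Vec? 4 λ ω → _ ℕ.≤? 8) _

κ-peak : Vec Bool 4
κ-peak = false ∷ true ∷ false ∷ false ∷ []

κ-walsh-fibres-at-peak : κ-walsh-fibre false κ-peak ≡ + 8 × κ-walsh-fibre true κ-peak ≡ + 0
κ-walsh-fibres-at-peak = refl , refl

concatFam-++ : ∀ s t (T : Vec Bool s → BF t) u v → concatFam s t T (u ++ v) ≡ T u v
concatFam-++ zero    t T []      v = refl
concatFam-++ (suc s) t T (x ∷ u) v = concatFam-++ s t (λ u′ → T (x ∷ u′)) u v

cat4-entry : ∀ {m} (T₁ T₂ T₃ T₄ : BF m) c₁ c₂ z →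
             cat4 T₁ T₂ T₃ T₄ (c₁ ∷ c₂ ∷ z) ≡ block₄ (T₁ z) (T₂ z) (T₃ z) (T₄ z) (c₁ ∷ c₂ ∷ [])
cat4-entry T₁ T₂ T₃ T₄ false false z = refl
cat4-entry T₁ T₂ T₃ T₄ false true  z = refl
cat4-entry T₁ T₂ T₃ T₄ true  false z = refl
cat4-entry T₁ T₂ T₃ T₄ true  true  z = refl

-- a ∈ V_1 chooses P or Q, (b, y) ∈ V_{k-1} the block and (c₁, c₂, z) ∈ V_k the position in it.
embed : ∀ {j} → Vec Bool 4 → Vec Bool (2 + j) → Vec Bool (2 + j) → Vec Bool ((4 + j) + (4 + j))
embed (a ∷ b ∷ c₁ ∷ c₂ ∷ []) y z = a ∷ (b ∷ y) ++ (c₁ ∷ c₂ ∷ z)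

embed-⊕ : ∀ {j} u u′ (y y′ z z′ : Vec Bool (2 + j)) → embed u y z ⊕ embed u′ y′ z′ ≡ embed (u ⊕ u′) (y ⊕ y′) (z ⊕ z′)
embed-⊕ (a ∷ b ∷ c₁ ∷ c₂ ∷ []) (a′ ∷ b′ ∷ c₁′ ∷ c₂′ ∷ []) y y′ z z′ =
  cong ((a xor a′) ∷_) (⊕-++ (b ∷ y) (b′ ∷ y′) (c₁ ∷ c₂ ∷ z) (c₁′ ∷ c₂′ ∷ z′))

dot-embed : ∀ {j} u u′ (y y′ z z′ : Vec Bool (2 + j)) → dot (embed u y z) (embed u′ y′ z′) ≡ (dot u u′ xor dot y y′) xor dot z z′
dot-embed (a ∷ b ∷ c₁ ∷ c₂ ∷ []) (a′ ∷ b′ ∷ c₁′ ∷ c₂′ ∷ []) y y′ z z′ =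
  trans (cong ((a ∧ a′) xor_) (dot-++ (b ∷ y) (b′ ∷ y′) (c₁ ∷ c₂ ∷ z) (c₁′ ∷ c₂′ ∷ z′)))
        (law (a ∧ a′) (b ∧ b′) (dot y y′) (c₁ ∧ c₁′) (c₂ ∧ c₂′) (dot z z′))
  where
  law : ∀ p q r s t w → p xor ((q xor r) xor (s xor (t xor w))) ≡ ((p xor (q xor (s xor (t xor false)))) xor r) xor w
  law = decide (∀-Bool? λ p → ∀-Bool? λ q → ∀-Bool? λ r → ∀-Bool? λ s → ∀-Bool? λ t → ∀-Bool? λ w → _ BP.≟ _) _

embed-surjective : ∀ {j} (x : Vec Bool ((4 + j) + (4 + j))) → ∃ λ u → ∃ λ y → ∃ λ z → x ≡ embed u y z
embed-surjective {j} (a ∷ x) with splitAt (3 + j) x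
... | b ∷ y , c₁ ∷ c₂ ∷ z , x≡ = a ∷ b ∷ c₁ ∷ c₂ ∷ [] , y , z , cong (a ∷_) x≡

sumℤ-embed : ∀ j (F : Vec Bool ((4 + j) + (4 + j)) → ℤ) →
  sumℤ ((4 + j) + (4 + j)) F ≡ sumℤ 4 (λ u → sumℤ (2 + j) (λ y → sumℤ (2 + j) (λ z → F (embed u y z))))
sumℤ-embed j F = cong₂ ℤ._+_ (split false) (split true)
  where
  m : ℕ
  m = 2 + j
  split : ∀ a → sumℤ ((3 + j) + (4 + j)) (λ x → F (a ∷ x))
              ≡ sumℤ 3 (λ v → sumℤ m (λ y → sumℤ m (λ z → F (embed (a ∷ v) y z))))
  split a = trans (sumℤ-++ (3 + j) (4 + j) (λ x → F (a ∷ x))) (cong₂ ℤ._+_ (swap false) (swap true))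
    where
    swap : ∀ b → sumℤ m (λ y → sumℤ (2 + m) (λ w → F (a ∷ (b ∷ y) ++ w)))
               ≡ sumℤ 2 (λ c → sumℤ m (λ y → sumℤ m (λ z → F (embed (a ∷ b ∷ c) y z))))
    swap b = trans (sumℤ-cong m (λ y → sumℤ-++ 2 m (λ w → F (a ∷ (b ∷ y) ++ w))))
                   (sumℤ-swap m 2 (λ y c → sumℤ m (λ z → F (a ∷ (b ∷ y) ++ (c ++ z)))))

sumℤ-at-0ᵥ : ∀ m c → sumℤ m (λ x → if isZero x then c else + 0) ≡ c
sumℤ-at-0ᵥ m c = trans (sumℤ-cong m (λ x → cong (λ v → if isZero v then c else + 0) (sym (⊕-identityʳ x))))
                       (sumℤ-point m (λ _ → c) 0ᵥ)

sumℤ-concentrated : ∀ j (F : Vec Bool ((4 + j) + (4 + j)) → ℤ) (G : Vec Bool 4 → ℤ) →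
  (∀ u y z → F (embed u y z) ≡ (if isZero y ∧ isZero z then G u else + 0)) →
  sumℤ ((4 + j) + (4 + j)) F ≡ sumℤ 4 G
sumℤ-concentrated j F G F≡ = trans (sumℤ-embed j F) (sumℤ-cong 4 λ u → begin
  sumℤ m (λ y → sumℤ m (λ z → F (embed u y z)))                                         ≡⟨ sumℤ-cong m (λ y → sumℤ-cong m (F≡ u y)) ⟩
  sumℤ m (λ y → sumℤ m (λ z → if isZero y ∧ isZero z then G u else + 0))                ≡⟨ sumℤ-cong m (λ y → inner {G u} (isZero y)) ⟩
  sumℤ m (λ y → if isZero y then G u else + 0)                                           ≡⟨ sumℤ-at-0ᵥ m (G u) ⟩
  G u                                                                                    ∎)
  where
  open ≡-Reasoning
  m : ℕ
  m = 2 + j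
  inner : ∀ {c} b → sumℤ m (λ z → if b ∧ isZero z then c else + 0) ≡ (if b then c else + 0)
  inner {c} true  = sumℤ-at-0ᵥ m c
  inner     false = sumℤ-zero m

module Corollary5 (j : ℕ) (g : Vec Bool (2 + j) → BF (2 + j)) (affine : ∀ i → Affine (2 + j) (g i))
                  (balanced : ∀ i i′ → ¬ i ≡ i′ → Balanced (2 + j) (λ x → g i x xor g i′ x)) where
  open Construction j g

  m n : ℕ
  m = 2 + j
  n = (4 + j) + (4 + j)

  L : Vec Bool m → Vec Bool m
  L i = proj₁ (affine i)

  e : Vec Bool m → Bool
  e i = proj₁ (proj₂ (affine i))

  g≡ : ∀ i z → g i z ≡ dot (L i) z xor e i
  g≡ i = proj₂ (proj₂ (affine i))

  L-injective : ∀ y y′ → L y ≡ L y′ → y ≡ y′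
  L-injective y y′ Ly≡Ly′ with ≡-dec BP._≟_ y y′
  ... | yes y≡y′ = y≡y′
  ... | no  y≢y′ = ⊥-elim (constant-not-balanced m (e y xor e y′)
                     (trans (count-cong m (λ x → sym (sum≡ x))) (trans (balanced y y′ y≢y′) (count-cong m (λ x → cong not (sum≡ x))))))
    where
    sum≡ : ∀ x → g y x xor g y′ x ≡ e y xor e y′
    sum≡ x rewrite g≡ y x | g≡ y′ x | Ly≡Ly′ = law (dot (L y′) x) (e y) (e y′)
      where
      law : ∀ d p q → (d xor p) xor (d xor q) ≡ p xor q
      law = decide (∀-Bool? λ d → ∀-Bool? λ p → ∀-Bool? λ q → _ BP.≟ _) _

  slope : Bool → Vec Bool m → Vec Bool m
  slope t y = if t then L y ⊕ leadingOnes j else L y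

  slope-injective : ∀ t y y′ → slope t y ≡ slope t y′ → y ≡ y′
  slope-injective false y y′ eq = L-injective y y′ eq
  slope-injective true  y y′ eq = L-injective y y′
    (trans (sym (⊕-cancelʳ (L y) (leadingOnes j))) (trans (cong (_⊕ leadingOnes j) eq) (⊕-cancelʳ (L y′) (leadingOnes j))))

  module MM (t : Bool) = MaioranaMcFarland (slope t) e (slope-injective t)

  mm : Bool → Vec Bool m → Vec Bool m → Bool
  mm t = MM.mm t

  f-entry : ∀ u y z → f (embed u y z) ≡ entry u (g y z) (h y z)
  f-entry (false ∷ false ∷ c₁ ∷ c₂ ∷ []) y z = trans (concatFam-++ (3 + j) (4 + j) P (false ∷ y) (c₁ ∷ c₂ ∷ z)) (cat4-entry _ _ _ _ c₁ c₂ z)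
  f-entry (false ∷ true  ∷ c₁ ∷ c₂ ∷ []) y z = trans (concatFam-++ (3 + j) (4 + j) P (true ∷ y) (c₁ ∷ c₂ ∷ z)) (cat4-entry _ _ _ _ c₁ c₂ z)
  f-entry (true  ∷ false ∷ c₁ ∷ c₂ ∷ []) y z = trans (concatFam-++ (3 + j) (4 + j) Q (false ∷ y) (c₁ ∷ c₂ ∷ z)) (cat4-entry _ _ _ _ c₁ c₂ z)
  f-entry (true  ∷ true  ∷ c₁ ∷ c₂ ∷ []) y z = trans (concatFam-++ (3 + j) (4 + j) Q (true ∷ y) (c₁ ∷ c₂ ∷ z)) (cat4-entry _ _ _ _ c₁ c₂ z)

  twist-slope : ∀ t y z → g y z xor (t ∧ dot (leadingOnes j) z) ≡ dot (slope t y) z xor e y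
  twist-slope false y z = trans (BP.xor-identityʳ (g y z)) (g≡ y z)
  twist-slope true  y z rewrite g≡ y z | dot-⊕ˡ (L y) (leadingOnes j) z = law (dot (L y) z) (e y) (dot (leadingOnes j) z)
    where
    law : ∀ a c s → (a xor c) xor s ≡ (a xor s) xor c
    law = decide (∀-Bool? λ a → ∀-Bool? λ c → ∀-Bool? λ s → _ BP.≟ _) _

  f-normal-form : ∀ u y z → f (embed u y z) ≡ mm (τ u) y z xor κ u
  f-normal-form u y z = begin
    f (embed u y z)                                    ≡⟨ f-entry u y z ⟩
    entry u (g y z) (h y z)                            ≡⟨ cong (entry u (g y z)) (O-affine j (g y) (affine y) z) ⟩
    entry u (g y z) (g y z xor S)                      ≡⟨ entry-normal-form u (g y z) S ⟩
    (g y z xor (τ u ∧ S)) xor κ u                      ≡⟨ cong (_xor κ u) (twist-slope (τ u) y z) ⟩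
    mm (τ u) y z xor κ u                               ∎
    where
    open ≡-Reasoning
    S : Bool
    S = dot (leadingOnes j) z

  K : ℤ
  K = + (2 ^ m)

  correlation-split : ∀ u y z αu β γ →
    sign (f (embed u y z)) ℤ.* sign (f (embed u y z ⊕ embed αu β γ))
      ≡ (sign (κ u) ℤ.* sign (κ (u ⊕ αu))) ℤ.* sign (mm (τ u) y z xor mm (τ u xor τ αu) (y ⊕ β) (z ⊕ γ))
  correlation-split u y z αu β γ
    rewrite embed-⊕ u αu y β z γ | f-normal-form u y z | f-normal-form (u ⊕ αu) (y ⊕ β) (z ⊕ γ) | τ-⊕ u αu
          | sign-xor (mm (τ u) y z) (κ u) | sign-xor (mm (τ u xor τ αu) (y ⊕ β) (z ⊕ γ)) (κ (u ⊕ αu))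
          | sign-xor (mm (τ u) y z) (mm (τ u xor τ αu) (y ⊕ β) (z ⊕ γ))
    = regroup (sign (mm (τ u) y z)) (sign (κ u)) (sign (mm (τ u xor τ αu) (y ⊕ β) (z ⊕ γ))) (sign (κ (u ⊕ αu)))
    where
    regroup : ∀ a k b k′ → a ℤ.* k ℤ.* (b ℤ.* k′) ≡ k ℤ.* k′ ℤ.* (a ℤ.* b)
    regroup = solve-∀

  cross-correlation : Bool → Bool → Vec Bool m → Vec Bool m → ℤ
  cross-correlation t t′ β γ = sumℤ m (λ y → sumℤ m (λ z → sign (mm t y z xor mm t′ (y ⊕ β) (z ⊕ γ))))

  Δ-f-factorised : ∀ αu β γ → Δ n f (embed αu β γ)
    ≡ sumℤ 4 (λ u → (sign (κ u) ℤ.* sign (κ (u ⊕ αu))) ℤ.* cross-correlation (τ u) (τ u xor τ αu) β γ)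
  Δ-f-factorised αu β γ = begin
    Δ n f (embed αu β γ)
      ≡⟨ sumℤ-embed j (λ x → sign (f x) ℤ.* sign (f (x ⊕ embed αu β γ))) ⟩
    sumℤ 4 (λ u → sumℤ m (λ y → sumℤ m (λ z → sign (f (embed u y z)) ℤ.* sign (f (embed u y z ⊕ embed αu β γ)))))
      ≡⟨ sumℤ-cong 4 (λ u → sumℤ-cong m (λ y → sumℤ-cong m (λ z → correlation-split u y z αu β γ))) ⟩
    sumℤ 4 (λ u → sumℤ m (λ y → sumℤ m (λ z → F u ℤ.* term u y z)))
      ≡⟨ sumℤ-cong 4 (λ u → trans (sumℤ-cong m (λ y → sumℤ-*ˡ m (F u) (term u y)))
                                  (sumℤ-*ˡ m (F u) (λ y → sumℤ m (term u y)))) ⟩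
    sumℤ 4 (λ u → F u ℤ.* cross-correlation (τ u) (τ u xor τ αu) β γ)
      ∎
    where
    open ≡-Reasoning
    F : Vec Bool 4 → ℤ
    F u = sign (κ u) ℤ.* sign (κ (u ⊕ αu))
    term : Vec Bool 4 → Vec Bool m → Vec Bool m → ℤ
    term u y z = sign (mm (τ u) y z xor mm (τ u xor τ αu) (y ⊕ β) (z ⊕ γ))

  Δ-f : ∀ αu β γ → Δ n f (embed αu β γ) ≡ (if isZero β ∧ isZero γ then K ℤ.* K ℤ.* Δ 4 κ αu else + 0)
  Δ-f αu β γ = trans (Δ-f-factorised αu β γ) (by-τ (τ αu) refl)
    where
    open ≡-Reasoning
    F : Vec Bool 4 → ℤ
    F u = sign (κ u) ℤ.* sign (κ (u ⊕ αu))
    Z : ℤ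
    Z = if isZero β ∧ isZero γ then K ℤ.* K else + 0
    cross : Bool → Bool → ℤ
    cross s t = cross-correlation t (t xor s) β γ
    scale : ∀ b (w : ℤ) → w ℤ.* (if b then K ℤ.* K else + 0) ≡ (if b then K ℤ.* K ℤ.* w else + 0)
    scale true  w = ℤP.*-comm w (K ℤ.* K)
    scale false w = ℤP.*-zeroʳ w
    by-τ : ∀ s → τ αu ≡ s → sumℤ 4 (λ u → F u ℤ.* cross s (τ u)) ≡ (if isZero β ∧ isZero γ then K ℤ.* K ℤ.* Δ 4 κ αu else + 0)
    by-τ false _ = begin
      sumℤ 4 (λ u → F u ℤ.* cross false (τ u))     ≡⟨ sumℤ-cong 4 (λ u → cong (F u ℤ.*_) (autocorrelation (τ u))) ⟩
      sumℤ 4 (λ u → F u ℤ.* Z)                 ≡⟨ sumℤ-*ʳ 4 F Z ⟩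
      Δ 4 κ αu ℤ.* Z                           ≡⟨ scale (isZero β ∧ isZero γ) (Δ 4 κ αu) ⟩
      (if isZero β ∧ isZero γ then K ℤ.* K ℤ.* Δ 4 κ αu else + 0) ∎
      where
      autocorrelation : ∀ t → cross false t ≡ Z
      autocorrelation t = trans (cong (λ t′ → cross-correlation t t′ β γ) (BP.xor-identityʳ t)) (MM.mm-autocorrelation t β γ)
    by-τ true τα≡ with κ-correlation-fibres-vanish αu τα≡
    ... | A₀≡0 , A₁≡0 , Δκ≡0 = begin
      sumℤ 4 (λ u → F u ℤ.* cross true (τ u))
        ≡⟨ sumℤ-fibres 4 τ F (cross true) ⟩
      κ-correlation-fibre false αu ℤ.* cross true false ℤ.+ κ-correlation-fibre true αu ℤ.* cross true true
        ≡⟨ cong₂ (λ a b → a ℤ.* cross true false ℤ.+ b ℤ.* cross true true) A₀≡0 A₁≡0 ⟩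
      + 0 ℤ.* cross true false ℤ.+ + 0 ℤ.* cross true true
        ≡⟨ cong₂ ℤ._+_ (ℤP.*-zeroˡ (cross true false)) (ℤP.*-zeroˡ (cross true true)) ⟩
      + 0
        ≡⟨ trans (cong (ℤ._* Z) Δκ≡0) (ℤP.*-zeroˡ Z) ⟨
      Δ 4 κ αu ℤ.* Z
        ≡⟨ scale (isZero β ∧ isZero γ) (Δ 4 κ αu) ⟩
      (if isZero β ∧ isZero γ then K ℤ.* K ℤ.* Δ 4 κ αu else + 0) ∎

  walsh-mm : Bool → Vec Bool m → Vec Bool m → ℤ
  walsh-mm t ωy ωz = sumℤ m (λ y → sumℤ m (λ z → sign ((mm t y z xor dot ωy y) xor dot ωz z)))

  walsh-split : ∀ u y z ωu ωy ωz →
    sign (f (embed u y z) xor dot (embed ωu ωy ωz) (embed u y z))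
      ≡ sign (κ u xor dot ωu u) ℤ.* sign ((mm (τ u) y z xor dot ωy y) xor dot ωz z)
  walsh-split u y z ωu ωy ωz
    rewrite f-normal-form u y z | dot-embed ωu u ωy y ωz z =
    trans (cong sign (law (mm (τ u) y z) (κ u) (dot ωu u) (dot ωy y) (dot ωz z)))
          (sign-xor (κ u xor dot ωu u) ((mm (τ u) y z xor dot ωy y) xor dot ωz z))
    where
    law : ∀ p k a b c → (p xor k) xor ((a xor b) xor c) ≡ (k xor a) xor ((p xor b) xor c)
    law = decide (∀-Bool? λ p → ∀-Bool? λ k → ∀-Bool? λ a → ∀-Bool? λ b → ∀-Bool? λ c → _ BP.≟ _) _

  walsh-f : ∀ ωu ωy ωz → walsh n f (embed ωu ωy ωz)
    ≡ κ-walsh-fibre false ωu ℤ.* walsh-mm false ωy ωz ℤ.+ κ-walsh-fibre true ωu ℤ.* walsh-mm true ωy ωz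
  walsh-f ωu ωy ωz = begin
    walsh n f ω
      ≡⟨ sumℤ-embed j (λ x → sign (f x xor dot ω x)) ⟩
    sumℤ 4 (λ u → sumℤ m (λ y → sumℤ m (λ z → sign (f (embed u y z) xor dot ω (embed u y z)))))
      ≡⟨ sumℤ-cong 4 (λ u → sumℤ-cong m (λ y → sumℤ-cong m (λ z → walsh-split u y z ωu ωy ωz))) ⟩
    sumℤ 4 (λ u → sumℤ m (λ y → sumℤ m (λ z → F u ℤ.* row (τ u) y z)))
      ≡⟨ sumℤ-cong 4 (λ u → trans (sumℤ-cong m (λ y → sumℤ-*ˡ m (F u) (row (τ u) y)))
                                  (sumℤ-*ˡ m (F u) (λ y → sumℤ m (row (τ u) y)))) ⟩
    sumℤ 4 (λ u → F u ℤ.* walsh-mm (τ u) ωy ωz)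
      ≡⟨ sumℤ-fibres 4 τ F (λ t → walsh-mm t ωy ωz) ⟩
    κ-walsh-fibre false ωu ℤ.* walsh-mm false ωy ωz ℤ.+ κ-walsh-fibre true ωu ℤ.* walsh-mm true ωy ωz ∎
    where
    open ≡-Reasoning
    ω : Vec Bool n
    ω = embed ωu ωy ωz
    F : Vec Bool 4 → ℤ
    F u = sign (κ u xor dot ωu u)
    row : Bool → Vec Bool m → Vec Bool m → ℤ
    row t y z = sign ((mm t y z xor dot ωy y) xor dot ωz z)

  8*2^m : 8 * 2 ^ m ≡ 2 ^ (4 + j) + 2 ^ (4 + j)
  8*2^m = eight-quarters (2 ^ j)
    where
    eight-quarters : ∀ q → 8 * (2 * (2 * q)) ≡ 2 * (2 * (2 * (2 * q))) + 2 * (2 * (2 * (2 * q)))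
    eight-quarters = ℕSolver.solve-∀

  walsh-f-bound : ∀ ω → ∣ walsh n f ω ∣ ≤ 2 ^ (4 + j) + 2 ^ (4 + j)
  walsh-f-bound ω with embed-surjective ω
  ... | ωu , ωy , ωz , refl = begin
    ∣ walsh n f (embed ωu ωy ωz) ∣              ≡⟨ cong ∣_∣ (walsh-f ωu ωy ωz) ⟩
    ∣ T₀ ℤ.* W₀ ℤ.+ T₁ ℤ.* W₁ ∣                ≤⟨ ℤP.∣i+j∣≤∣i∣+∣j∣ (T₀ ℤ.* W₀) (T₁ ℤ.* W₁) ⟩
    ∣ T₀ ℤ.* W₀ ∣ + ∣ T₁ ℤ.* W₁ ∣              ≡⟨ cong₂ _+_ (ℤP.abs-* T₀ W₀) (ℤP.abs-* T₁ W₁) ⟩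
    ∣ T₀ ∣ * ∣ W₀ ∣ + ∣ T₁ ∣ * ∣ W₁ ∣          ≤⟨ ℕP.+-mono-≤ (ℕP.*-monoʳ-≤ ∣ T₀ ∣ (MM.mm-walsh-bound false ωy ωz))
                                                              (ℕP.*-monoʳ-≤ ∣ T₁ ∣ (MM.mm-walsh-bound true ωy ωz)) ⟩
    ∣ T₀ ∣ * 2 ^ m + ∣ T₁ ∣ * 2 ^ m            ≡⟨ ℕP.*-distribʳ-+ (2 ^ m) ∣ T₀ ∣ ∣ T₁ ∣ ⟨
    (∣ T₀ ∣ + ∣ T₁ ∣) * 2 ^ m                  ≤⟨ ℕP.*-monoˡ-≤ (2 ^ m) (κ-walsh-fibres-bound ωu) ⟩
    8 * 2 ^ m                                  ≡⟨ 8*2^m ⟩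
    2 ^ (4 + j) + 2 ^ (4 + j)                  ∎
    where
    open ℕP.≤-Reasoning
    T₀ T₁ W₀ W₁ : ℤ
    T₀ = κ-walsh-fibre false ωu
    T₁ = κ-walsh-fibre true ωu
    W₀ = walsh-mm false ωy ωz
    W₁ = walsh-mm true ωy ωz

  peak-point : Vec Bool n
  peak-point = embed κ-peak 0ᵥ (L 0ᵥ)

  walsh-f-peak : ∣ walsh n f peak-point ∣ ≡ 2 ^ (4 + j) + 2 ^ (4 + j)
  walsh-f-peak = begin
    ∣ walsh n f peak-point ∣                                  ≡⟨ cong ∣_∣ (walsh-f κ-peak 0ᵥ (L 0ᵥ)) ⟩
    ∣ T₀ ℤ.* W₀ ℤ.+ T₁ ℤ.* W₁ ∣                               ≡⟨ cong₂ (λ a b → ∣ a ℤ.* W₀ ℤ.+ b ℤ.* W₁ ∣) (proj₁ κ-walsh-fibres-at-peak) (proj₂ κ-walsh-fibres-at-peak) ⟩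
    ∣ + 8 ℤ.* W₀ ℤ.+ + 0 ℤ.* W₁ ∣                             ≡⟨ cong (λ w → ∣ + 8 ℤ.* W₀ ℤ.+ w ∣) (ℤP.*-zeroˡ W₁) ⟩
    ∣ + 8 ℤ.* W₀ ℤ.+ + 0 ∣                                    ≡⟨ cong ∣_∣ (ℤP.+-identityʳ (+ 8 ℤ.* W₀)) ⟩
    ∣ + 8 ℤ.* W₀ ∣                                            ≡⟨ ℤP.abs-* (+ 8) W₀ ⟩
    8 * ∣ W₀ ∣                                                ≡⟨ cong (λ w → 8 * ∣ w ∣) (MM.mm-walsh-peak false 0ᵥ) ⟩
    8 * ∣ K ℤ.* sign (e 0ᵥ) ∣                                 ≡⟨ cong (8 *_) (ℤP.abs-* K (sign (e 0ᵥ))) ⟩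
    8 * (2 ^ m * ∣ sign (e 0ᵥ) ∣)                             ≡⟨ cong (λ s → 8 * (2 ^ m * s)) (∣sign∣ (e 0ᵥ)) ⟩
    8 * (2 ^ m * 1)                                           ≡⟨ cong (8 *_) (ℕP.*-identityʳ (2 ^ m)) ⟩
    8 * 2 ^ m                                                 ≡⟨ 8*2^m ⟩
    2 ^ (4 + j) + 2 ^ (4 + j)                                 ∎
    where
    open ≡-Reasoning
    T₀ T₁ W₀ W₁ : ℤ
    T₀ = κ-walsh-fibre false κ-peak
    T₁ = κ-walsh-fibre true κ-peak
    W₀ = walsh-mm false 0ᵥ (L 0ᵥ)
    W₁ = walsh-mm true 0ᵥ (L 0ᵥ)

  Δ-f-square : ∀ u y z → Δ n f (embed u y z) ℤ.* Δ n f (embed u y z)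
    ≡ (if isZero y ∧ isZero z then (K ℤ.* K ℤ.* Δ 4 κ u) ℤ.* (K ℤ.* K ℤ.* Δ 4 κ u) else + 0)
  Δ-f-square u y z = trans (cong₂ ℤ._*_ (Δ-f u y z) (Δ-f u y z)) (square (isZero y ∧ isZero z))
    where
    square : ∀ b → (if b then K ℤ.* K ℤ.* Δ 4 κ u else + 0) ℤ.* (if b then K ℤ.* K ℤ.* Δ 4 κ u else + 0)
                 ≡ (if b then (K ℤ.* K ℤ.* Δ 4 κ u) ℤ.* (K ℤ.* K ℤ.* Δ 4 κ u) else + 0)
    square true  = refl
    square false = refl

  σ-f : σ n f ≡ + (2 ^ (2 * n + 2))
  σ-f = begin
    σ n f                                                   ≡⟨ sumℤ-concentrated j (λ α → Δ n f α ℤ.* Δ n f α) KKΔ² Δ-f-square ⟩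
    sumℤ 4 KKΔ²                                             ≡⟨ sumℤ-cong 4 (λ α → regroup K (Δ 4 κ α)) ⟩
    sumℤ 4 (λ α → K ℤ.* K ℤ.* (K ℤ.* K) ℤ.* (Δ 4 κ α ℤ.* Δ 4 κ α))  ≡⟨ sumℤ-*ˡ 4 (K ℤ.* K ℤ.* (K ℤ.* K)) (λ α → Δ 4 κ α ℤ.* Δ 4 κ α) ⟩
    K ℤ.* K ℤ.* (K ℤ.* K) ℤ.* σ 4 κ                         ≡⟨ cong (K ℤ.* K ℤ.* (K ℤ.* K) ℤ.*_) σ-κ ⟩
    K ℤ.* K ℤ.* (K ℤ.* K) ℤ.* + 1024                        ≡⟨ cong (ℤ._* + 1024) (cong₂ ℤ._*_ (ℤP.pos-* (2 ^ m) (2 ^ m)) (ℤP.pos-* (2 ^ m) (2 ^ m))) ⟨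
    + (2 ^ m * 2 ^ m) ℤ.* + (2 ^ m * 2 ^ m) ℤ.* + 1024       ≡⟨ cong (ℤ._* + 1024) (ℤP.pos-* (2 ^ m * 2 ^ m) (2 ^ m * 2 ^ m)) ⟨
    + (2 ^ m * 2 ^ m * (2 ^ m * 2 ^ m)) ℤ.* + 1024           ≡⟨ ℤP.pos-* (2 ^ m * 2 ^ m * (2 ^ m * 2 ^ m)) 1024 ⟨
    + (2 ^ m * 2 ^ m * (2 ^ m * 2 ^ m) * 1024)               ≡⟨ cong +_ power ⟩
    + (2 ^ (2 * n + 2))                                     ∎
    where
    open ≡-Reasoning
    KKΔ² : Vec Bool 4 → ℤ
    KKΔ² α = (K ℤ.* K ℤ.* Δ 4 κ α) ℤ.* (K ℤ.* K ℤ.* Δ 4 κ α)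
    regroup : ∀ k d → (k ℤ.* k ℤ.* d) ℤ.* (k ℤ.* k ℤ.* d) ≡ k ℤ.* k ℤ.* (k ℤ.* k) ℤ.* (d ℤ.* d)
    regroup = solve-∀
    exponent : ∀ j → 2 * ((4 + j) + (4 + j)) + 2 ≡ ((2 + j + (2 + j)) + (2 + j + (2 + j))) + 10
    exponent = ℕSolver.solve-∀
    power : 2 ^ m * 2 ^ m * (2 ^ m * 2 ^ m) * 1024 ≡ 2 ^ (2 * n + 2)
    power = sym (begin
      2 ^ (2 * n + 2)                            ≡⟨ cong (2 ^_) (exponent j) ⟩
      2 ^ (((m + m) + (m + m)) + 10)             ≡⟨ ℕP.^-distribˡ-+-* 2 ((m + m) + (m + m)) 10 ⟩
      2 ^ ((m + m) + (m + m)) * 1024             ≡⟨ cong (_* 1024) (ℕP.^-distribˡ-+-* 2 (m + m) (m + m)) ⟩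
      2 ^ (m + m) * 2 ^ (m + m) * 1024           ≡⟨ cong (_* 1024) (cong₂ _*_ (ℕP.^-distribˡ-+-* 2 m m) (ℕP.^-distribˡ-+-* 2 m m)) ⟩
      2 ^ m * 2 ^ m * (2 ^ m * 2 ^ m) * 1024     ∎)

  K*K≢0 : ¬ K ℤ.* K ≡ + 0
  K*K≢0 eq = [ +2^≢0 m , +2^≢0 m ]′ (ℤP.i*j≡0⇒i≡0∨j≡0 K eq)

  Δ-f-nonzero : ∀ u y z → indicator (ΔnonzeroB n f (embed u y z))
    ≡ (if isZero y ∧ isZero z then indicator (ΔnonzeroB 4 κ u) else + 0)
  Δ-f-nonzero u y z = trans (cong (λ w → indicator (not ⌊ w ℤP.≟ + 0 ⌋)) (Δ-f u y z)) (on-plane (isZero y ∧ isZero z))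
    where
    on-plane : ∀ b → indicator (not ⌊ (if b then K ℤ.* K ℤ.* Δ 4 κ u else + 0) ℤP.≟ + 0 ⌋)
                     ≡ (if b then indicator (ΔnonzeroB 4 κ u) else + 0)
    on-plane true  = cong (λ b → indicator (not b)) (≟0-*ˡ (K ℤ.* K) (Δ 4 κ u) K*K≢0)
    on-plane false = refl

  count-f : count n (ΔnonzeroB n f) ≡ 4
  count-f = ℤP.+-injective (begin
    + count n (ΔnonzeroB n f)                        ≡⟨ count-indicator n (ΔnonzeroB n f) ⟩
    sumℤ n (λ α → indicator (ΔnonzeroB n f α))       ≡⟨ sumℤ-concentrated j (λ α → indicator (ΔnonzeroB n f α)) (λ α → indicator (ΔnonzeroB 4 κ α)) Δ-f-nonzero ⟩
    sumℤ 4 (λ α → indicator (ΔnonzeroB 4 κ α))       ≡⟨ count-κ ⟩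
    + 4                                              ∎)
    where open ≡-Reasoning

  Δ-f-extremal : ∀ α → ¬ Δ n f α ≡ + 0 → ∣ Δ n f α ∣ ≡ 2 ^ n
  Δ-f-extremal α Δ≢0 with embed-surjective α
  ... | αu , β , γ , refl = on-plane (isZero β ∧ isZero γ) (Δ-f αu β γ)
    where
    open ≡-Reasoning
    sixteen : ∀ q → 2 * (2 * q) * (2 * (2 * q)) * 16 ≡ 2 * (2 * (2 * (2 * q))) * (2 * (2 * (2 * (2 * q))))
    sixteen = ℕSolver.solve-∀
    on-κ-support : ∣ Δ 4 κ αu ∣ ≡ 16 → ∣ K ℤ.* K ℤ.* Δ 4 κ αu ∣ ≡ 2 ^ n
    on-κ-support ∣Δκ∣≡16 = begin
      ∣ K ℤ.* K ℤ.* Δ 4 κ αu ∣             ≡⟨ trans (ℤP.abs-* (K ℤ.* K) (Δ 4 κ αu)) (cong₂ _*_ (ℤP.abs-* K K) ∣Δκ∣≡16) ⟩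
      2 ^ m * 2 ^ m * 16                    ≡⟨ sixteen (2 ^ j) ⟩
      2 ^ (4 + j) * 2 ^ (4 + j)             ≡⟨ ℕP.^-distribˡ-+-* 2 (4 + j) (4 + j) ⟨
      2 ^ n                                 ∎
    on-plane : ∀ b → Δ n f (embed αu β γ) ≡ (if b then K ℤ.* K ℤ.* Δ 4 κ αu else + 0) → ∣ Δ n f (embed αu β γ) ∣ ≡ 2 ^ n
    on-plane false Δ≡ = ⊥-elim (Δ≢0 Δ≡)
    on-plane true  Δ≡ = trans (cong ∣_∣ Δ≡) ([ off-κ-support , on-κ-support ]′ (κ-Δ-values αu))
      where
      off-κ-support : ∣ Δ 4 κ αu ∣ ≡ 0 → ∣ K ℤ.* K ℤ.* Δ 4 κ αu ∣ ≡ 2 ^ n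
      off-κ-support ∣Δκ∣≡0 = ⊥-elim (Δ≢0 (trans Δ≡ (trans (cong (K ℤ.* K ℤ.*_) (ℤP.∣i∣≡0⇒i≡0 ∣Δκ∣≡0)) (ℤP.*-zeroʳ (K ℤ.* K)))))

  linear-structures : ∀ α → ¬ α ≡ 0ᵥ → ¬ Δ n f α ≡ + 0 → LinearStructure n f α
  linear-structures α α≢0 Δ≢0 = α≢0 , Δ-extremal⇒linear n f α (Δ-f-extremal α Δ≢0)

  Δ-f-at-0 : ¬ Δ n f 0ᵥ ≡ + 0
  Δ-f-at-0 Δ≡0 = +2^≢0 n (trans (sym (Δ-zero n f)) Δ≡0)

  N-f : N n f ≡ 2 ^ (n ∸ 1) ∸ 2 ^ (4 + j)
  N-f = nonlinearity-from-walsh ((3 + j) + (4 + j)) f (2 ^ (4 + j)) walsh-f-bound peak-point walsh-f-peak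

corollary5 : (j : ℕ) → (g : Vec Bool (2 + j) → BF (2 + j)) →
  (∀ i → Affine (2 + j) (g i)) →
  count (2 + j) (λ i → basedOn A j (g i)) ≡ 2 ^ j →
  count (2 + j) (λ i → basedOn B j (g i)) ≡ 2 ^ j →
  count (2 + j) (λ i → basedOn C j (g i)) ≡ 2 ^ j →
  count (2 + j) (λ i → basedOn D j (g i)) ≡ 2 ^ j →
  (∀ i i′ → ¬ (i ≡ i′) → Balanced (2 + j) (λ x → g i x xor g i′ x)) →
  let k = 4 + j
      n = k + k
      f = Construction.f j g
  in (σ n f ≡ + (2 ^ (2 * n + 2)))
   × (N n f ≡ 2 ^ (n ∸ 1) ∸ 2 ^ k)
   × (count n (ΔnonzeroB n f) ≡ 4)
   × (¬ (Δ n f (replicate n Bool.false) ≡ + 0))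
   × (∀ α → ¬ (α ≡ replicate n Bool.false) → ¬ (Δ n f α ≡ + 0) → LinearStructure n f α)
corollary5 j g affine _ _ _ _ balanced = σ-f , N-f , count-f , Δ-f-at-0 , linear-structures
  where open Corollary5 j g affine balanced
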